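{- Let $t(n)=\operatorname{num}_{\mathcal T}(n,1)$ for $n\ge1$ and $t(0)=1$. Then $t(3n)=t(3n+1)=t(3n+2)$ for all $n\ge0$, and $t(3n)-t(3n-2)=2^{2n}t(n)$ for all $n\ge1$.
   Context: A ternary partition of $n$ is a partition of $n$ (a finite nonincreasing sequence of positive integers summing to $n$) all of whose parts are powers of $3$ (including $1$); let $\mathcal T(n)$ be the set of ternary partitions of $n$, and let $m_\lambda(i)$ be the number of parts of $\lambda$ equal to $i$. For $\lambda\in\mathcal T(n)$ set $h_{\mathcal T,\lambda}(x)=\prod_{k\ge0}(1+x^{3^k})^{\lfloor n/3^k\rfloor-m_\lambda(3^k)}$, let $G_{\mathcal T}(n,x)$ be the greatest common divisor in $\mathbb{Z}[x]$ (positive leading coefficient) of the $h_{\mathcal T,\lambda}(x)$ over $\lambda\in\mathcal T(n)$, and define the polynomial $\operatorname{num}_{\mathcal T}(n,x)=\frac{1}{G_{\mathcal T}(n,x)}\sum_{\lambda\in\mathcal T(n)}h_{\mathcal T,\lambda}(x)$. -}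

module Defs where

open import Data.Nat as ℕ using (ℕ; zero; suc; _^_; _/_; _∸_)
open import Data.Nat.Properties using (m^n≢0)
open import Data.Integer as ℤ using (ℤ; +_; _+_; _*_; 0ℤ; 1ℤ; _>_)
open import Data.List using (List; []; _∷_; map; foldr; length; filter; replicate; _++_)
open import Data.List.Relation.Unary.All using (All)
open import Data.List.Relation.Unary.Unique.Propositional using (Unique)
open import Data.List.Relation.Unary.Linked using (Linked)
open import Data.List.Membership.Propositional using (_∈_)
open import Data.Product using (Σ; ∃; _×_)
open import Relation.Binary.PropositionalEquality using (_≡_)
open import Function.Bundles using (_⇔_)

-- Polynomials in ℤ[x] as coefficient lists (constant term first).
-- Equality is coefficientwise (so trailing zeros are irrelevant).

Poly : Set
Poly = List ℤ

coeff : Poly → ℕ → ℤ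
coeff []       _       = 0ℤ
coeff (a ∷ p)  zero    = a
coeff (a ∷ p)  (suc i) = coeff p i

_≈ₚ_ : Poly → Poly → Set
p ≈ₚ q = ∀ i → coeff p i ≡ coeff q i

infix 4 _≈ₚ_ _∣ₚ_
infixl 6 _+ₚ_
infixl 7 _*ₚ_ _·ₚ_

_+ₚ_ : Poly → Poly → Poly
[]      +ₚ q       = q
(a ∷ p) +ₚ []      = a ∷ p
(a ∷ p) +ₚ (b ∷ q) = (a + b) ∷ (p +ₚ q)

_·ₚ_ : ℤ → Poly → Poly
c ·ₚ p = map (c *_) p

_*ₚ_ : Poly → Poly → Poly
[]      *ₚ q = []
(a ∷ p) *ₚ q = (a ·ₚ q) +ₚ (0ℤ ∷ (p *ₚ q))

oneₚ : Poly
oneₚ = 1ℤ ∷ []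

monomial : ℕ → Poly
monomial d = replicate d 0ℤ ++ (1ℤ ∷ [])

_^ₚ_ : Poly → ℕ → Poly
p ^ₚ zero  = oneₚ
p ^ₚ suc e = p *ₚ (p ^ₚ e)

prodₚ : List Poly → Poly
prodₚ = foldr _*ₚ_ oneₚ

sumₚ : List Poly → Poly
sumₚ = foldr _+ₚ_ []

eval : Poly → ℤ → ℤ
eval []      x = 0ℤ
eval (a ∷ p) x = a + x * eval p x

_∣ₚ_ : Poly → Poly → Set
d ∣ₚ p = ∃ λ q → d *ₚ q ≈ₚ p

LeadPos : Poly → Set
LeadPos p = Σ ℕ λ d → (coeff p d > 0ℤ) × (∀ i → d ℕ.< i → coeff p i ≡ 0ℤ)

IsGcdₚ : Poly → List Poly → Set
IsGcdₚ G hs = LeadPos G × All (G ∣ₚ_) hs × (∀ D → All (D ∣ₚ_) hs → D ∣ₚ G)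

sumℕ : List ℕ → ℕ
sumℕ = foldr ℕ._+_ 0

IsPow3 : ℕ → Set
IsPow3 p = ∃ λ k → p ≡ 3 ^ k

IsTernaryPartition : ℕ → List ℕ → Set
IsTernaryPartition n λ′ = Linked ℕ._≥_ λ′ × All IsPow3 λ′ × sumℕ λ′ ≡ n

EnumeratesT : ℕ → List (List ℕ) → Set
EnumeratesT n L = Unique L × (∀ λ′ → (λ′ ∈ L) ⇔ IsTernaryPartition n λ′)

mult : List ℕ → ℕ → ℕ
mult λ′ i = length (filter (ℕ._≟ i) λ′)

onePlusX3k : ℕ → Poly
onePlusX3k k = oneₚ +ₚ monomial (3 ^ k)

hFactors : ℕ → List ℕ → ℕ → List Poly
hFactors n λ′ zero    = []
hFactors n λ′ (suc k) =
  (onePlusX3k k ^ₚ ((n / (3 ^ k)) {{m^n≢0 3 k}} ∸ mult λ′ (3 ^ k)))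
  ∷ hFactors n λ′ k

-- h_{𝒯,λ}(x) = ∏_{k≥0} (1+x^{3^k})^{⌊n/3^k⌋ - m_λ(3^k)}; the factors with
-- 3^k > n are 1, so the product over k = 0 .. n is the full product.
hT : ℕ → List ℕ → Poly
hT n λ′ = prodₚ (hFactors n λ′ (suc n))

{-# OPTIONS --safe #-}
-- Write Φ 0 = 1 + x and Φ (k+1) = 1 − y + y² with y = x^{3^k}, so that 1 + x^{3^k} = Φ 0 ⋯ Φ k
-- and distinct Φ i, Φ j generate an ideal of ℤ[x] containing a power of 3. Then
-- h_λ = ∏_j Φ j ^ (A_j − #{parts of λ that are ≥ 3^j}) with A_j = Σ_{k ≥ j} ⌊n/3^k⌋. At most
-- ⌊n/3^j⌋ parts are ≥ 3^j, with equality for λ = (3^j)^{⌊n/3^j⌋} 1^…, so the gcd is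
-- G = ∏_j Φ j ^ (A_j − ⌊n/3^j⌋): a common divisor D of these extremal h_λ is not ≡ 0 mod 3
-- (their values at 1 are powers of 2) and divides G times a product free of Φ j for every j,
-- so Gauss's lemma at 3 lets us strip the cofactors one Φ j at a time.
-- At x = 1 every Φ j but Φ 0 = 2 equals 1, hence t(n) = Σ_λ 2^{n − ℓ(λ)}. Writing
-- λ = 3μ ∪ 1^{n−3m} with μ a ternary partition of m ≤ n/3 gives t(n) = Σ_{m ≤ n/3} 4^m t(m),
-- which depends on n only through ⌊n/3⌋ and yields t(3n) − t(3n−2) = 4^n t(n).
module Submission where

open import Defs
open import Data.Nat using (ℕ)

module PolynomialRing where

  open import Data.Nat using (zero; suc)
  open import Data.Integer using (_+_; _*_; -_; 0ℤ; 1ℤ; -1ℤ)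
  import Data.Integer.Properties as ℤ
  open import Data.Integer.Tactic.RingSolver using (solve-∀)
  open import Data.List using ([]; _∷_)
  open import Data.Maybe using (Maybe; just; nothing)
  open import Relation.Nullary using (yes)
  open import Data.Product using (_,_)
  open import Level using (0ℓ)
  open import Algebra.Bundles using (CommutativeRing)
  import Tactic.RingSolver.Core.AlmostCommutativeRing as ACR
  import Relation.Binary.Reasoning.Setoid
  open import Relation.Binary.PropositionalEquality
  open ≡-Reasoning

  infix 4 _≈_
  record _≈_ (p q : Poly) : Set where
    constructor mk≈
    field at : p ≈ₚ q
  open _≈_ public

  ≈-refl : ∀ {p} → p ≈ p
  ≈-refl = mk≈ λ _ → refl

  ≈-reflexive : ∀ {p q} → p ≡ q → p ≈ q
  ≈-reflexive refl = ≈-refl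

  ≈-sym : ∀ {p q} → p ≈ q → q ≈ p
  ≈-sym e = mk≈ λ i → sym (at e i)

  ≈-trans : ∀ {p q r} → p ≈ q → q ≈ r → p ≈ r
  ≈-trans e f = mk≈ λ i → trans (at e i) (at f i)

  shift : Poly → Poly
  shift p = 0ℤ ∷ p

  shift-cong : ∀ {p q} → p ≈ q → shift p ≈ shift q
  shift-cong e = mk≈ λ { zero → refl ; (suc i) → at e i }

  shift-[] : shift [] ≈ []
  shift-[] = mk≈ λ { zero → refl ; (suc i) → refl }

  coeff-+ₚ : ∀ p q i → coeff (p +ₚ q) i ≡ coeff p i + coeff q i
  coeff-+ₚ []      q       i       = sym (ℤ.+-identityˡ _)
  coeff-+ₚ (a ∷ p) []      i       = sym (ℤ.+-identityʳ _)
  coeff-+ₚ (a ∷ p) (b ∷ q) zero    = refl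
  coeff-+ₚ (a ∷ p) (b ∷ q) (suc i) = coeff-+ₚ p q i

  coeff-·ₚ : ∀ c p i → coeff (c ·ₚ p) i ≡ c * coeff p i
  coeff-·ₚ c []      i       = sym (ℤ.*-zeroʳ c)
  coeff-·ₚ c (a ∷ p) zero    = refl
  coeff-·ₚ c (a ∷ p) (suc i) = coeff-·ₚ c p i

  coeff-shift-·ₚ : ∀ c p i → coeff (shift (c ·ₚ p)) i ≡ c * coeff (shift p) i
  coeff-shift-·ₚ c p zero    = sym (ℤ.*-zeroʳ c)
  coeff-shift-·ₚ c p (suc i) = coeff-·ₚ c p i

  coeff-∷*ₚ : ∀ a p q i → coeff ((a ∷ p) *ₚ q) i ≡ a * coeff q i + coeff (shift (p *ₚ q)) i
  coeff-∷*ₚ a p q i =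
    trans (coeff-+ₚ (a ·ₚ q) (shift (p *ₚ q)) i) (cong (_+ coeff (shift (p *ₚ q)) i) (coeff-·ₚ a q i))

  +ₚ-cong : ∀ {p p′ q q′} → p ≈ p′ → q ≈ q′ → p +ₚ q ≈ p′ +ₚ q′
  +ₚ-cong {p} {p′} {q} {q′} e f = mk≈ λ i → begin
    coeff (p +ₚ q) i         ≡⟨ coeff-+ₚ p q i ⟩
    coeff p i + coeff q i    ≡⟨ cong₂ _+_ (at e i) (at f i) ⟩
    coeff p′ i + coeff q′ i  ≡⟨ coeff-+ₚ p′ q′ i ⟨
    coeff (p′ +ₚ q′) i       ∎

  ·ₚ-cong : ∀ c {p q} → p ≈ q → c ·ₚ p ≈ c ·ₚ q
  ·ₚ-cong c {p} {q} e = mk≈ λ i →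
    trans (coeff-·ₚ c p i) (trans (cong (c *_) (at e i)) (sym (coeff-·ₚ c q i)))

  +ₚ-comm : ∀ p q → p +ₚ q ≈ q +ₚ p
  +ₚ-comm p q = mk≈ λ i →
    trans (coeff-+ₚ p q i) (trans (ℤ.+-comm (coeff p i) (coeff q i)) (sym (coeff-+ₚ q p i)))

  +ₚ-assoc : ∀ p q r → (p +ₚ q) +ₚ r ≈ p +ₚ (q +ₚ r)
  +ₚ-assoc p q r = mk≈ λ i → begin
    coeff ((p +ₚ q) +ₚ r) i                ≡⟨ coeff-+ₚ (p +ₚ q) r i ⟩
    coeff (p +ₚ q) i + coeff r i           ≡⟨ cong (_+ coeff r i) (coeff-+ₚ p q i) ⟩
    (coeff p i + coeff q i) + coeff r i    ≡⟨ ℤ.+-assoc (coeff p i) (coeff q i) (coeff r i) ⟩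
    coeff p i + (coeff q i + coeff r i)    ≡⟨ cong (coeff p i +_) (coeff-+ₚ q r i) ⟨
    coeff p i + coeff (q +ₚ r) i           ≡⟨ coeff-+ₚ p (q +ₚ r) i ⟨
    coeff (p +ₚ (q +ₚ r)) i                ∎

  +ₚ-identityʳ : ∀ p → p +ₚ [] ≈ p
  +ₚ-identityʳ p = mk≈ λ i → trans (coeff-+ₚ p [] i) (ℤ.+-identityʳ _)

  negₚ : Poly → Poly
  negₚ p = -1ℤ ·ₚ p

  +ₚ-inverseˡ : ∀ p → negₚ p +ₚ p ≈ []
  +ₚ-inverseˡ p = mk≈ λ i → begin
    coeff (negₚ p +ₚ p) i             ≡⟨ coeff-+ₚ (negₚ p) p i ⟩
    coeff (negₚ p) i + coeff p i      ≡⟨ cong (_+ coeff p i) (coeff-·ₚ -1ℤ p i) ⟩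
    -1ℤ * coeff p i + coeff p i       ≡⟨ cong (_+ coeff p i) (ℤ.-1*i≡-i (coeff p i)) ⟩
    - coeff p i + coeff p i           ≡⟨ ℤ.+-inverseˡ (coeff p i) ⟩
    0ℤ                                ∎

  +ₚ-inverseʳ : ∀ p → p +ₚ negₚ p ≈ []
  +ₚ-inverseʳ p = ≈-trans (+ₚ-comm p (negₚ p)) (+ₚ-inverseˡ p)

  *ₚ-zeroˡ-≈ : ∀ {p} q → [] ≈ p → p *ₚ q ≈ []
  *ₚ-zeroˡ-≈ {[]}    q e = ≈-refl
  *ₚ-zeroˡ-≈ {b ∷ p} q e = mk≈ λ i → begin
    coeff ((b ∷ p) *ₚ q) i                       ≡⟨ coeff-∷*ₚ b p q i ⟩
    b * coeff q i + coeff (shift (p *ₚ q)) i     ≡⟨ cong₂ (λ u v → u * coeff q i + v) (sym (at e 0)) (at p*q≈[] i) ⟩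
    0ℤ                                           ∎
    where
    p*q≈[] : shift (p *ₚ q) ≈ []
    p*q≈[] = ≈-trans (shift-cong (*ₚ-zeroˡ-≈ {p} q (mk≈ λ j → at e (suc j)))) shift-[]

  *ₚ-congʳ : ∀ {p p′} q → p ≈ p′ → p *ₚ q ≈ p′ *ₚ q
  *ₚ-congʳ {[]}    {p′}     q e = ≈-sym (*ₚ-zeroˡ-≈ q e)
  *ₚ-congʳ {a ∷ p} {[]}     q e = *ₚ-zeroˡ-≈ q (≈-sym e)
  *ₚ-congʳ {a ∷ p} {b ∷ p′} q e = mk≈ λ i → begin
    coeff ((a ∷ p) *ₚ q) i                        ≡⟨ coeff-∷*ₚ a p q i ⟩
    a * coeff q i + coeff (shift (p *ₚ q)) i      ≡⟨ cong₂ (λ u v → u * coeff q i + v) (at e 0) (at tail≈ i) ⟩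
    b * coeff q i + coeff (shift (p′ *ₚ q)) i     ≡⟨ coeff-∷*ₚ b p′ q i ⟨
    coeff ((b ∷ p′) *ₚ q) i                       ∎
    where
    tail≈ : shift (p *ₚ q) ≈ shift (p′ *ₚ q)
    tail≈ = shift-cong (*ₚ-congʳ {p} {p′} q (mk≈ λ j → at e (suc j)))

  *ₚ-congˡ : ∀ p {q q′} → q ≈ q′ → p *ₚ q ≈ p *ₚ q′
  *ₚ-congˡ []      e = ≈-refl
  *ₚ-congˡ (a ∷ p) {q} {q′} e = mk≈ λ i → begin
    coeff ((a ∷ p) *ₚ q) i                        ≡⟨ coeff-∷*ₚ a p q i ⟩
    a * coeff q i + coeff (shift (p *ₚ q)) i      ≡⟨ cong₂ (λ u v → a * u + v) (at e i) (at (shift-cong (*ₚ-congˡ p e)) i) ⟩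
    a * coeff q′ i + coeff (shift (p *ₚ q′)) i    ≡⟨ coeff-∷*ₚ a p q′ i ⟨
    coeff ((a ∷ p) *ₚ q′) i                       ∎

  *ₚ-cong : ∀ {p p′ q q′} → p ≈ p′ → q ≈ q′ → p *ₚ q ≈ p′ *ₚ q′
  *ₚ-cong {p′ = p′} {q = q} e f = ≈-trans (*ₚ-congʳ q e) (*ₚ-congˡ p′ f)

  shift-+ₚ : ∀ p q → shift (p +ₚ q) ≈ shift p +ₚ shift q
  shift-+ₚ p q = mk≈ λ { zero → refl ; (suc i) → refl }

  shift-*ₚ : ∀ p q → shift p *ₚ q ≈ shift (p *ₚ q)
  shift-*ₚ p q = mk≈ λ i → trans (coeff-∷*ₚ 0ℤ p q i) (ℤ.+-identityˡ _)

  *ₚ-distribˡ-+ₚ : ∀ p q r → p *ₚ (q +ₚ r) ≈ p *ₚ q +ₚ p *ₚ r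
  *ₚ-distribˡ-+ₚ []      q r = ≈-refl
  *ₚ-distribˡ-+ₚ (a ∷ p) q r = mk≈ λ i → begin
    coeff ((a ∷ p) *ₚ (q +ₚ r)) i
      ≡⟨ coeff-∷*ₚ a p (q +ₚ r) i ⟩
    a * coeff (q +ₚ r) i + coeff (shift (p *ₚ (q +ₚ r))) i
      ≡⟨ cong₂ (λ u v → a * u + v) (coeff-+ₚ q r i) (trans (at tail≈ i) (coeff-+ₚ (shift (p *ₚ q)) (shift (p *ₚ r)) i)) ⟩
    a * (coeff q i + coeff r i) + (coeff (shift (p *ₚ q)) i + coeff (shift (p *ₚ r)) i)
      ≡⟨ regroup a (coeff q i) (coeff r i) _ _ ⟩
    (a * coeff q i + coeff (shift (p *ₚ q)) i) + (a * coeff r i + coeff (shift (p *ₚ r)) i)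
      ≡⟨ cong₂ _+_ (coeff-∷*ₚ a p q i) (coeff-∷*ₚ a p r i) ⟨
    coeff ((a ∷ p) *ₚ q) i + coeff ((a ∷ p) *ₚ r) i
      ≡⟨ coeff-+ₚ ((a ∷ p) *ₚ q) _ i ⟨
    coeff ((a ∷ p) *ₚ q +ₚ (a ∷ p) *ₚ r) i
      ∎
    where
    tail≈ : shift (p *ₚ (q +ₚ r)) ≈ shift (p *ₚ q) +ₚ shift (p *ₚ r)
    tail≈ = ≈-trans (shift-cong (*ₚ-distribˡ-+ₚ p q r)) (shift-+ₚ (p *ₚ q) (p *ₚ r))
    regroup : ∀ a x y u v → a * (x + y) + (u + v) ≡ (a * x + u) + (a * y + v)
    regroup = solve-∀

  *ₚ-zeroʳ : ∀ p → p *ₚ [] ≈ []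
  *ₚ-zeroʳ []      = ≈-refl
  *ₚ-zeroʳ (a ∷ p) = mk≈ λ i → trans (coeff-∷*ₚ a p [] i)
    (cong₂ _+_ (ℤ.*-zeroʳ a) (at (≈-trans (shift-cong (*ₚ-zeroʳ p)) shift-[]) i))

  *ₚ-identityˡ : ∀ p → oneₚ *ₚ p ≈ p
  *ₚ-identityˡ p = mk≈ λ i → trans (coeff-∷*ₚ 1ℤ [] p i)
    (trans (cong₂ _+_ (ℤ.*-identityˡ (coeff p i)) (at shift-[] i)) (ℤ.+-identityʳ _))

  ·ₚ-*ₚ-assoc : ∀ c q r → (c ·ₚ q) *ₚ r ≈ c ·ₚ (q *ₚ r)
  ·ₚ-*ₚ-assoc c []      r = ≈-refl
  ·ₚ-*ₚ-assoc c (b ∷ q) r = mk≈ λ i → begin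
    coeff ((c * b ∷ c ·ₚ q) *ₚ r) i
      ≡⟨ coeff-∷*ₚ (c * b) (c ·ₚ q) r i ⟩
    (c * b) * coeff r i + coeff (shift ((c ·ₚ q) *ₚ r)) i
      ≡⟨ cong ((c * b) * coeff r i +_) (trans (at (shift-cong (·ₚ-*ₚ-assoc c q r)) i) (coeff-shift-·ₚ c (q *ₚ r) i)) ⟩
    (c * b) * coeff r i + c * coeff (shift (q *ₚ r)) i
      ≡⟨ factor c b (coeff r i) _ ⟩
    c * (b * coeff r i + coeff (shift (q *ₚ r)) i)
      ≡⟨ cong (c *_) (coeff-∷*ₚ b q r i) ⟨
    c * coeff ((b ∷ q) *ₚ r) i
      ≡⟨ coeff-·ₚ c ((b ∷ q) *ₚ r) i ⟨
    coeff (c ·ₚ ((b ∷ q) *ₚ r)) i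
      ∎
    where
    factor : ∀ c b x u → (c * b) * x + c * u ≡ c * (b * x + u)
    factor = solve-∀

  *ₚ-∷ : ∀ p b q → p *ₚ (b ∷ q) ≈ b ·ₚ p +ₚ shift (p *ₚ q)
  *ₚ-∷ []      b q = ≈-sym shift-[]
  *ₚ-∷ (a ∷ p) b q = mk≈ λ
    { zero → trans (ℤ.+-identityʳ (a * b)) (trans (ℤ.*-comm a b) (sym (ℤ.+-identityʳ (b * a))))
    ; (suc i) → begin
      coeff ((a ∷ p) *ₚ (b ∷ q)) (suc i)
        ≡⟨ coeff-∷*ₚ a p (b ∷ q) (suc i) ⟩
      a * coeff q i + coeff (p *ₚ (b ∷ q)) i
        ≡⟨ cong (a * coeff q i +_) (trans (at (*ₚ-∷ p b q) i) (coeff-+ₚ (b ·ₚ p) _ i)) ⟩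
      a * coeff q i + (coeff (b ·ₚ p) i + coeff (shift (p *ₚ q)) i)
        ≡⟨ swap (a * coeff q i) (coeff (b ·ₚ p) i) _ ⟩
      coeff (b ·ₚ p) i + (a * coeff q i + coeff (shift (p *ₚ q)) i)
        ≡⟨ cong (coeff (b ·ₚ p) i +_) (coeff-∷*ₚ a p q i) ⟨
      coeff (b ·ₚ p) i + coeff ((a ∷ p) *ₚ q) i
        ≡⟨ coeff-+ₚ (b ·ₚ p) ((a ∷ p) *ₚ q) i ⟨
      coeff (b ·ₚ p +ₚ (a ∷ p) *ₚ q) i
        ∎ }
    where
    swap : ∀ x y z → x + (y + z) ≡ y + (x + z)
    swap = solve-∀

  *ₚ-comm : ∀ p q → p *ₚ q ≈ q *ₚ p
  *ₚ-comm []      q = ≈-sym (*ₚ-zeroʳ q)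
  *ₚ-comm (a ∷ p) q = ≈-trans (+ₚ-cong (≈-refl {a ·ₚ q}) (shift-cong (*ₚ-comm p q))) (≈-sym (*ₚ-∷ q a p))

  *ₚ-distribʳ-+ₚ : ∀ r p q → (p +ₚ q) *ₚ r ≈ p *ₚ r +ₚ q *ₚ r
  *ₚ-distribʳ-+ₚ r p q = ≈-trans (*ₚ-comm (p +ₚ q) r)
    (≈-trans (*ₚ-distribˡ-+ₚ r p q) (+ₚ-cong (*ₚ-comm r p) (*ₚ-comm r q)))

  *ₚ-assoc : ∀ p q r → (p *ₚ q) *ₚ r ≈ p *ₚ (q *ₚ r)
  *ₚ-assoc []      q r = ≈-refl
  *ₚ-assoc (a ∷ p) q r =
    ≈-trans (*ₚ-distribʳ-+ₚ r (a ·ₚ q) (shift (p *ₚ q)))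
      (+ₚ-cong (·ₚ-*ₚ-assoc a q r) (≈-trans (shift-*ₚ (p *ₚ q) r) (shift-cong (*ₚ-assoc p q r))))

  *ₚ-identityʳ : ∀ p → p *ₚ oneₚ ≈ p
  *ₚ-identityʳ p = ≈-trans (*ₚ-comm p oneₚ) (*ₚ-identityˡ p)

  commutativeRing : CommutativeRing 0ℓ 0ℓ
  commutativeRing = record
    { Carrier = Poly ; _≈_ = _≈_ ; _+_ = _+ₚ_ ; _*_ = _*ₚ_ ; -_ = negₚ ; 0# = [] ; 1# = oneₚ
    ; isCommutativeRing = record
      { isRing = record
        { +-isAbelianGroup = record
          { isGroup = record
            { isMonoid = record
              { isSemigroup = record
                { isMagma = record
                  { isEquivalence = record { refl = ≈-refl ; sym = ≈-sym ; trans = ≈-trans }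
                  ; ∙-cong = +ₚ-cong }
                ; assoc = +ₚ-assoc }
              ; identity = (λ _ → ≈-refl) , +ₚ-identityʳ }
            ; inverse = +ₚ-inverseˡ , +ₚ-inverseʳ
            ; ⁻¹-cong = ·ₚ-cong -1ℤ }
          ; comm = +ₚ-comm }
        ; *-cong = *ₚ-cong
        ; *-assoc = *ₚ-assoc
        ; *-identity = *ₚ-identityˡ , *ₚ-identityʳ
        ; distrib = *ₚ-distribˡ-+ₚ , *ₚ-distribʳ-+ₚ }
      ; *-comm = *ₚ-comm } }

  module ≈-Reasoning = Relation.Binary.Reasoning.Setoid (CommutativeRing.setoid commutativeRing)

  -- The solver cancels monomials only when it can recognise their coefficient as zero.
  ≈[]? : (p : Poly) → Maybe ([] ≈ p)
  ≈[]? []      = just ≈-refl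
  ≈[]? (a ∷ p) with a ℤ.≟ 0ℤ | ≈[]? p
  ... | yes refl | just []≈p = just (mk≈ λ { zero → refl ; (suc i) → at []≈p i })
  ... | _        | _         = nothing

  open import Tactic.RingSolver.NonReflective (ACR.fromCommutativeRing commutativeRing ≈[]?) public
    using (solve; Κ; _⊕_; _⊗_; ⊝_; _⊜_)

module PolynomialProperties where

  open PolynomialRing

  open import Data.Nat as ℕ using (ℕ; zero; suc; _<_; s≤s; z≤n)
  import Data.Nat.Properties as ℕ
  open import Data.Integer as ℤ using (_+_; _*_; +_; 0ℤ; 1ℤ; _>_)
  import Data.Integer.Properties as ℤ
  open import Data.Integer.Tactic.RingSolver using (solve-∀)
  open import Data.List using ([]; _∷_)
  open import Data.Product using (_,_)
  open import Function using (_∘′_)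
  open import Data.Empty using (⊥-elim)
  open import Relation.Binary.PropositionalEquality
  open ≡-Reasoning

  ^ₚ-congˡ : ∀ {p q} k → p ≈ q → p ^ₚ k ≈ q ^ₚ k
  ^ₚ-congˡ zero    p≈q = ≈-refl
  ^ₚ-congˡ (suc k) p≈q = *ₚ-cong p≈q (^ₚ-congˡ k p≈q)

  ^ₚ-+ : ∀ p m n → p ^ₚ (m ℕ.+ n) ≈ p ^ₚ m *ₚ p ^ₚ n
  ^ₚ-+ p zero    n = ≈-sym (*ₚ-identityˡ (p ^ₚ n))
  ^ₚ-+ p (suc m) n = ≈-trans (*ₚ-congˡ p (^ₚ-+ p m n)) (≈-sym (*ₚ-assoc p (p ^ₚ m) (p ^ₚ n)))

  ^ₚ-distrib-*ₚ : ∀ p q k → (p *ₚ q) ^ₚ k ≈ p ^ₚ k *ₚ q ^ₚ k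
  ^ₚ-distrib-*ₚ p q zero    = ≈-sym (*ₚ-identityˡ oneₚ)
  ^ₚ-distrib-*ₚ p q (suc k) = ≈-trans (*ₚ-congˡ (p *ₚ q) (^ₚ-distrib-*ₚ p q k))
    (solve 4 (λ p q a b → (p ⊗ q) ⊗ (a ⊗ b) ⊜ (p ⊗ a) ⊗ (q ⊗ b)) ≈-refl p q (p ^ₚ k) (q ^ₚ k))

  monomial-+ : ∀ a b → monomial (a ℕ.+ b) ≈ monomial a *ₚ monomial b
  monomial-+ zero    b = ≈-sym (*ₚ-identityˡ (monomial b))
  monomial-+ (suc a) b = ≈-trans (shift-cong (monomial-+ a b)) (≈-sym (shift-*ₚ (monomial a) (monomial b)))

  coeff-monomial-≡ : ∀ d → coeff (monomial d) d ≡ 1ℤ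
  coeff-monomial-≡ zero    = refl
  coeff-monomial-≡ (suc d) = coeff-monomial-≡ d

  coeff-monomial-≢ : ∀ {d i} → d ≢ i → coeff (monomial d) i ≡ 0ℤ
  coeff-monomial-≢ {zero}  {zero}  d≢i = ⊥-elim (d≢i refl)
  coeff-monomial-≢ {zero}  {suc i} d≢i = refl
  coeff-monomial-≢ {suc d} {zero}  d≢i = refl
  coeff-monomial-≢ {suc d} {suc i} d≢i = coeff-monomial-≢ (d≢i ∘′ cong suc)

  eval-+ₚ : ∀ p q x → eval (p +ₚ q) x ≡ eval p x + eval q x
  eval-+ₚ []      q       x = sym (ℤ.+-identityˡ _)
  eval-+ₚ (a ∷ p) []      x = sym (ℤ.+-identityʳ _)
  eval-+ₚ (a ∷ p) (b ∷ q) x =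
    trans (cong (λ z → (a + b) + x * z) (eval-+ₚ p q x)) (regroup a b x (eval p x) (eval q x))
    where
    regroup : ∀ a b x u v → (a + b) + x * (u + v) ≡ (a + x * u) + (b + x * v)
    regroup = solve-∀

  eval-·ₚ : ∀ c p x → eval (c ·ₚ p) x ≡ c * eval p x
  eval-·ₚ c []      x = sym (ℤ.*-zeroʳ c)
  eval-·ₚ c (a ∷ p) x = trans (cong (λ z → c * a + x * z) (eval-·ₚ c p x)) (factor c a x (eval p x))
    where
    factor : ∀ c a x u → c * a + x * (c * u) ≡ c * (a + x * u)
    factor = solve-∀

  eval-*ₚ : ∀ p q x → eval (p *ₚ q) x ≡ eval p x * eval q x
  eval-*ₚ []      q x = refl
  eval-*ₚ (a ∷ p) q x = begin
    eval (a ·ₚ q +ₚ shift (p *ₚ q)) x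
      ≡⟨ eval-+ₚ (a ·ₚ q) (shift (p *ₚ q)) x ⟩
    eval (a ·ₚ q) x + (0ℤ + x * eval (p *ₚ q) x)
      ≡⟨ cong₂ (λ u v → u + (0ℤ + x * v)) (eval-·ₚ a q x) (eval-*ₚ p q x) ⟩
    a * eval q x + (0ℤ + x * (eval p x * eval q x))
      ≡⟨ factor a (eval q x) x (eval p x) ⟩
    (a + x * eval p x) * eval q x
      ∎
    where
    factor : ∀ a e x u → a * e + (0ℤ + x * (u * e)) ≡ (a + x * u) * e
    factor = solve-∀

  eval-oneₚ : ∀ x → eval oneₚ x ≡ 1ℤ
  eval-oneₚ x = trans (cong (λ z → 1ℤ + z) (ℤ.*-zeroʳ x)) (ℤ.+-identityʳ 1ℤ)

  eval-^ₚ : ∀ p k x → eval (p ^ₚ k) x ≡ eval p x ℤ.^ k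
  eval-^ₚ p zero    x = eval-oneₚ x
  eval-^ₚ p (suc k) x = trans (eval-*ₚ p (p ^ₚ k) x) (cong (eval p x *_) (eval-^ₚ p k x))

  eval-monomial : ∀ d x → eval (monomial d) x ≡ x ℤ.^ d
  eval-monomial zero    x = eval-oneₚ x
  eval-monomial (suc d) x = trans (ℤ.+-identityˡ _) (cong (x *_) (eval-monomial d x))

  pos-^ : ∀ m n → (+ m) ℤ.^ n ≡ + (m ℕ.^ n)
  pos-^ m zero    = refl
  pos-^ m (suc n) = trans (cong (+ m *_) (pos-^ m n)) (sym (ℤ.pos-* m (m ℕ.^ n)))

  ·ₚ-·ₚ : ∀ c d X → c ·ₚ (d ·ₚ X) ≈ (c * d) ·ₚ X
  ·ₚ-·ₚ c d X = mk≈ λ i → trans (coeff-·ₚ c (d ·ₚ X) i)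
    (trans (cong (c *_) (coeff-·ₚ d X i)) (trans (sym (ℤ.*-assoc c d _)) (sym (coeff-·ₚ (c * d) X i))))

  1·ₚ : ∀ X → 1ℤ ·ₚ X ≈ X
  1·ₚ X = mk≈ λ i → trans (coeff-·ₚ 1ℤ X i) (ℤ.*-identityˡ _)

  ·ₚ-cancelˡ : ∀ c .{{_ : ℤ.NonZero c}} X Y → c ·ₚ X ≈ c ·ₚ Y → X ≈ Y
  ·ₚ-cancelˡ c X Y cX≈cY = mk≈ λ i → ℤ.*-cancelˡ-≡ c (coeff X i) (coeff Y i)
    (trans (sym (coeff-·ₚ c X i)) (trans (at cX≈cY i) (coeff-·ₚ c Y i)))

  *ₚ-·ₚ : ∀ D c X → D *ₚ (c ·ₚ X) ≈ c ·ₚ (D *ₚ X)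
  *ₚ-·ₚ D c X = ≈-trans (*ₚ-comm D (c ·ₚ X)) (≈-trans (·ₚ-*ₚ-assoc c X D) (·ₚ-cong c (*ₚ-comm X D)))

  *ₚ-const : ∀ Q c → Q *ₚ (c ∷ []) ≈ c ·ₚ Q
  *ₚ-const Q c = ≈-trans (*ₚ-comm Q (c ∷ [])) (≈-trans (+ₚ-cong (≈-refl {c ·ₚ Q}) shift-[]) (+ₚ-identityʳ (c ·ₚ Q)))

  record Monic (d : ℕ) (p : Poly) : Set where
    constructor monic
    field
      lead  : coeff p d ≡ 1ℤ
      above : ∀ i → d < i → coeff p i ≡ 0ℤ

  Monic-resp-≈ : ∀ {d p q} → p ≈ q → Monic d p → Monic d q
  Monic-resp-≈ p≈q (monic lead above) =
    monic (trans (sym (at p≈q _)) lead) (λ i d<i → trans (sym (at p≈q i)) (above i d<i))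

  Monic-oneₚ : Monic 0 oneₚ
  Monic-oneₚ = monic refl λ { zero () ; (suc i) _ → refl }

  Monic-*ₚ : ∀ {d e p q} → Monic d p → Monic e q → Monic (d ℕ.+ e) (p *ₚ q)
  Monic-*ₚ {d}     {e} {[]}    {q} (monic () _)
  Monic-*ₚ {zero}  {e} {a ∷ p} {q} (monic a≡1 above) mq = Monic-resp-≈ q≈ mq
    where
    p≈[] : [] ≈ p
    p≈[] = mk≈ λ i → sym (above (suc i) (s≤s z≤n))
    q≈ : q ≈ (a ∷ p) *ₚ q
    q≈ = mk≈ λ i → sym (begin
      coeff ((a ∷ p) *ₚ q) i
        ≡⟨ coeff-∷*ₚ a p q i ⟩
      a * coeff q i + coeff (shift (p *ₚ q)) i
        ≡⟨ cong₂ (λ u v → u * coeff q i + v) a≡1 (at (≈-trans (shift-cong (*ₚ-zeroˡ-≈ q p≈[])) shift-[]) i) ⟩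
      1ℤ * coeff q i + 0ℤ
        ≡⟨ trans (ℤ.+-identityʳ _) (ℤ.*-identityˡ _) ⟩
      coeff q i
        ∎)
  Monic-*ₚ {suc d} {e} {a ∷ p} {q} (monic lead above) mq@(monic _ q-above) =
    monic (trans (coeff-suc (d ℕ.+ e) (ℕ.m≤n+m e d)) (Monic.lead ih))
      λ { zero () ; (suc i) (s≤s d+e<i) →
          trans (coeff-suc i (ℕ.≤-trans (ℕ.m≤n+m e d) (ℕ.<⇒≤ d+e<i))) (Monic.above ih i d+e<i) }
    where
    ih : Monic (d ℕ.+ e) (p *ₚ q)
    ih = Monic-*ₚ {p = p} (monic lead λ i d<i → above (suc i) (s≤s d<i)) mq
    coeff-suc : ∀ j → e ℕ.≤ j → coeff ((a ∷ p) *ₚ q) (suc j) ≡ coeff (p *ₚ q) j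
    coeff-suc j e≤j = begin
      coeff ((a ∷ p) *ₚ q) (suc j)                ≡⟨ coeff-∷*ₚ a p q (suc j) ⟩
      a * coeff q (suc j) + coeff (p *ₚ q) j      ≡⟨ cong (λ u → a * u + coeff (p *ₚ q) j) (q-above (suc j) (s≤s e≤j)) ⟩
      a * 0ℤ + coeff (p *ₚ q) j                   ≡⟨ cong (_+ coeff (p *ₚ q) j) (ℤ.*-zeroʳ a) ⟩
      0ℤ + coeff (p *ₚ q) j                       ≡⟨ ℤ.+-identityˡ _ ⟩
      coeff (p *ₚ q) j                            ∎

  Monic-monomial : ∀ d → Monic d (monomial d)
  Monic-monomial d = monic (coeff-monomial-≡ d) (λ i d<i → coeff-monomial-≢ (ℕ.<⇒≢ d<i))

  Monic-+ₚ-lower : ∀ {d p} q → (∀ i → d ℕ.≤ i → coeff q i ≡ 0ℤ) → Monic d p → Monic d (q +ₚ p)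
  Monic-+ₚ-lower {d} {p} q q-low (monic lead above) = monic
    (trans (coeff-+ₚ q p d) (trans (cong₂ _+_ (q-low d ℕ.≤-refl) lead) (ℤ.+-identityˡ 1ℤ)))
    (λ i d<i → trans (coeff-+ₚ q p i) (cong₂ _+_ (q-low i (ℕ.<⇒≤ d<i)) (above i d<i)))

  Monic-^ₚ : ∀ {d p} k → Monic d p → Monic (k ℕ.* d) (p ^ₚ k)
  Monic-^ₚ zero    mp = Monic-oneₚ
  Monic-^ₚ (suc k) mp = Monic-*ₚ mp (Monic-^ₚ k mp)

  Monic⇒LeadPos : ∀ {d p} → Monic d p → LeadPos p
  Monic⇒LeadPos {d} (monic lead above) = d , subst (_> 0ℤ) (sym lead) (ℤ.+<+ (s≤s z≤n)) , above

  ∣ₚ-respʳ-≈ : ∀ D X Y → D ∣ₚ X → X ≈ Y → D ∣ₚ Y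
  ∣ₚ-respʳ-≈ D X Y (R , DR≈X) X≈Y = R , λ i → trans (DR≈X i) (at X≈Y i)

  ∣ₚ-*ₚʳ : ∀ D X Z → D ∣ₚ X → D ∣ₚ X *ₚ Z
  ∣ₚ-*ₚʳ D X Z (R , DR≈X) = R *ₚ Z , at (≈-trans (≈-sym (*ₚ-assoc D R Z)) (*ₚ-congʳ Z (mk≈ {D *ₚ R} {X} DR≈X)))

module ThreeAdic where

  open PolynomialRing
  open PolynomialProperties

  open import Data.Nat as ℕ using (ℕ; zero; suc)
  import Data.Nat.Properties as ℕ
  import Data.Nat.Divisibility as ℕ
  open import Data.Nat.Primality using (Prime; prime?; euclidsLemma)
  open import Data.Integer as ℤ using (ℤ; _+_; _*_; +_; 0ℤ; 1ℤ)
  import Data.Integer.Properties as ℤ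
  open import Data.Integer.Divisibility.Signed as ℤ using (divides)
  open import Data.List using ([]; _∷_)
  open import Data.Product using (∃; _,_)
  open import Data.Empty using (⊥-elim)
  open import Data.Sum using (_⊎_; inj₁; inj₂)
  open import Relation.Nullary using (¬_)
  open import Relation.Nullary.Decidable using (from-yes)
  open import Relation.Binary.PropositionalEquality
  open ≈-Reasoning

  record 3∣ₚ_ (p : Poly) : Set where
    constructor 3∣ₚ⁺
    field 3∣coeff : ∀ i → + 3 ℤ.∣ coeff p i
  open 3∣ₚ_

  3∣0 : + 3 ℤ.∣ 0ℤ
  3∣0 = divides 0ℤ refl

  3∣ₚ[] : 3∣ₚ []
  3∣ₚ[] = 3∣ₚ⁺ λ _ → 3∣0

  3∣ₚ-∷ : ∀ {a p} → + 3 ℤ.∣ a → 3∣ₚ p → 3∣ₚ (a ∷ p)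
  3∣ₚ-∷ 3∣a 3∣p = 3∣ₚ⁺ λ { zero → 3∣a ; (suc i) → 3∣coeff 3∣p i }

  3∣ₚ-tail : ∀ {a p} → 3∣ₚ (a ∷ p) → 3∣ₚ p
  3∣ₚ-tail 3∣a∷p = 3∣ₚ⁺ λ i → 3∣coeff 3∣a∷p (suc i)

  3∣ₚ-resp-≈ : ∀ {p q} → p ≈ q → 3∣ₚ p → 3∣ₚ q
  3∣ₚ-resp-≈ p≈q 3∣p = 3∣ₚ⁺ λ i → subst (+ 3 ℤ.∣_) (at p≈q i) (3∣coeff 3∣p i)

  3∣ₚ-+ₚ : ∀ {p q} → 3∣ₚ p → 3∣ₚ q → 3∣ₚ (p +ₚ q)
  3∣ₚ-+ₚ {p} {q} 3∣p 3∣q = 3∣ₚ⁺ λ i →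
    subst (+ 3 ℤ.∣_) (sym (coeff-+ₚ p q i)) (ℤ.∣m∣n⇒∣m+n (3∣coeff 3∣p i) (3∣coeff 3∣q i))

  3∣ₚ-·ₚ : ∀ {c} p → + 3 ℤ.∣ c → 3∣ₚ (c ·ₚ p)
  3∣ₚ-·ₚ {c} p 3∣c = 3∣ₚ⁺ λ i → subst (+ 3 ℤ.∣_) (sym (coeff-·ₚ c p i)) (ℤ.∣m⇒∣m*n (coeff p i) 3∣c)

  3∣ₚ-*ₚʳ : ∀ D X → 3∣ₚ D → 3∣ₚ (D *ₚ X)
  3∣ₚ-*ₚʳ []      X 3∣D = 3∣ₚ[]
  3∣ₚ-*ₚʳ (a ∷ D) X 3∣D =
    3∣ₚ-+ₚ (3∣ₚ-·ₚ X (3∣coeff 3∣D 0)) (3∣ₚ-∷ 3∣0 (3∣ₚ-*ₚʳ D X (3∣ₚ-tail 3∣D)))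

  3∣ₚ⇒3∣eval : ∀ p x → 3∣ₚ p → + 3 ℤ.∣ eval p x
  3∣ₚ⇒3∣eval []      x 3∣p = 3∣0
  3∣ₚ⇒3∣eval (a ∷ p) x 3∣p =
    ℤ.∣m∣n⇒∣m+n (3∣coeff 3∣p 0) (ℤ.∣n⇒∣m*n x (3∣ₚ⇒3∣eval p x (3∣ₚ-tail 3∣p)))

  3∤ₚ-∣ₚ : ∀ D P x → D ∣ₚ P → ¬ (+ 3 ℤ.∣ eval P x) → ¬ 3∣ₚ D
  3∤ₚ-∣ₚ D P x (R , DR≈P) 3∤P 3∣D =
    3∤P (3∣ₚ⇒3∣eval P x (3∣ₚ-resp-≈ (mk≈ {D *ₚ R} DR≈P) (3∣ₚ-*ₚʳ D R 3∣D)))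

  3∣ₚ-shift⁻ : ∀ {c} X Y → + 3 ℤ.∣ c → 3∣ₚ (c ·ₚ X +ₚ shift Y) → 3∣ₚ Y
  3∣ₚ-shift⁻ {c} X Y 3∣c 3∣sum = 3∣ₚ⁺ λ i → ℤ.∣m+n∣m⇒∣n (3∣cX+Y i) (ℤ.∣m⇒∣m*n (coeff X (suc i)) 3∣c)
    where
    3∣cX+Y : ∀ i → + 3 ℤ.∣ c * coeff X (suc i) + coeff Y i
    3∣cX+Y i = subst (+ 3 ℤ.∣_)
      (trans (coeff-+ₚ (c ·ₚ X) (shift Y) (suc i)) (cong (_+ coeff Y i) (coeff-·ₚ c X (suc i))))
      (3∣coeff 3∣sum (suc i))

  prime-3 : Prime 3
  prime-3 = from-yes (prime? 3)

  3∣*⇒3∣∨3∣ : ∀ a b → + 3 ℤ.∣ a * b → + 3 ℤ.∣ a ⊎ + 3 ℤ.∣ b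
  3∣*⇒3∣∨3∣ a b 3∣ab
    with euclidsLemma ℤ.∣ a ∣ ℤ.∣ b ∣ prime-3 (subst (3 ℕ.∣_) (ℤ.abs-* a b) (ℤ.∣⇒∣ᵤ 3∣ab))
  ... | inj₁ 3∣a = inj₁ (ℤ.∣ᵤ⇒∣ 3∣a)
  ... | inj₂ 3∣b = inj₂ (ℤ.∣ᵤ⇒∣ 3∣b)

  3∤2^ : ∀ k → ¬ (+ 3 ℤ.∣ + (2 ℕ.^ k))
  3∤2^ k 3∣2^k = go k (ℤ.∣⇒∣ᵤ 3∣2^k)
    where
    go : ∀ k → ¬ (3 ℕ.∣ 2 ℕ.^ k)
    go zero    3∣1 with () ← ℕ.∣1⇒≡1 3∣1
    go (suc k) 3∣2*2^k with euclidsLemma 2 (2 ℕ.^ k) prime-3 3∣2*2^k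
    ... | inj₁ 3∣2   = ℕ.<-irrefl refl (ℕ.∣⇒≤ 3∣2)
    ... | inj₂ 3∣2^k = go k 3∣2^k

  3∣ₚ-*ₚ⁻ : ∀ D R → 3∣ₚ (D *ₚ R) → 3∣ₚ D ⊎ 3∣ₚ R
  3∣ₚ-*ₚ⁻ []      R _ = inj₁ 3∣ₚ[]
  3∣ₚ-*ₚ⁻ (d ∷ D) R = go R
    where
    go : ∀ R → 3∣ₚ ((d ∷ D) *ₚ R) → 3∣ₚ (d ∷ D) ⊎ 3∣ₚ R
    go []      _   = inj₂ 3∣ₚ[]
    go (r ∷ R) 3∣P with 3∣*⇒3∣∨3∣ d r (subst (+ 3 ℤ.∣_) (ℤ.+-identityʳ (d * r)) (3∣coeff 3∣P 0))
    ... | inj₁ 3∣d with 3∣ₚ-*ₚ⁻ D (r ∷ R) (3∣ₚ-shift⁻ (r ∷ R) (D *ₚ (r ∷ R)) 3∣d 3∣P)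
    ...   | inj₁ 3∣D = inj₁ (3∣ₚ-∷ 3∣d 3∣D)
    ...   | inj₂ 3∣R = inj₂ 3∣R
    go (r ∷ R) 3∣P | inj₂ 3∣r
      with go R (3∣ₚ-shift⁻ (d ∷ D) ((d ∷ D) *ₚ R) 3∣r (3∣ₚ-resp-≈ (*ₚ-∷ (d ∷ D) r R) 3∣P))
    ...   | inj₁ 3∣D = inj₁ 3∣D
    ...   | inj₂ 3∣R = inj₂ (3∣ₚ-∷ 3∣r 3∣R)

  3∣ₚ⇒≈3·ₚ : ∀ R → 3∣ₚ R → ∃ λ R′ → R ≈ + 3 ·ₚ R′
  3∣ₚ⇒≈3·ₚ []      _   = [] , ≈-refl
  3∣ₚ⇒≈3·ₚ (a ∷ R) 3∣R with 3∣coeff 3∣R 0 | 3∣ₚ⇒≈3·ₚ R (3∣ₚ-tail 3∣R)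
  ... | divides q a≡q*3 | R′ , R≈3R′ =
    q ∷ R′ , mk≈ λ { zero → trans a≡q*3 (ℤ.*-comm q (+ 3)) ; (suc i) → at R≈3R′ i }

  ∣ₚ-cancel-3 : ∀ D Q → ¬ 3∣ₚ D → D ∣ₚ + 3 ·ₚ Q → D ∣ₚ Q
  ∣ₚ-cancel-3 D Q 3∤D (R , DR≈3Q)
    with 3∣ₚ-*ₚ⁻ D R (3∣ₚ-resp-≈ (≈-sym (mk≈ {D *ₚ R} DR≈3Q)) (3∣ₚ-·ₚ Q (divides 1ℤ refl)))
  ... | inj₁ 3∣D = ⊥-elim (3∤D 3∣D)
  ... | inj₂ 3∣R with 3∣ₚ⇒≈3·ₚ R 3∣R
  ...   | R′ , R≈3R′ = R′ , at (·ₚ-cancelˡ (+ 3) (D *ₚ R′) Q (begin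
          + 3 ·ₚ (D *ₚ R′)   ≈⟨ *ₚ-·ₚ D (+ 3) R′ ⟨
          D *ₚ (+ 3 ·ₚ R′)   ≈⟨ *ₚ-congˡ D R≈3R′ ⟨
          D *ₚ R             ≈⟨ mk≈ {D *ₚ R} DR≈3Q ⟩
          + 3 ·ₚ Q           ∎))

  ∣ₚ-cancel-3^ : ∀ D Q s → ¬ 3∣ₚ D → D ∣ₚ + (3 ℕ.^ s) ·ₚ Q → D ∣ₚ Q
  ∣ₚ-cancel-3^ D Q zero    3∤D D∣Q = ∣ₚ-respʳ-≈ D _ _ D∣Q (1·ₚ Q)
  ∣ₚ-cancel-3^ D Q (suc s) 3∤D D∣3^[1+s]Q =
    ∣ₚ-cancel-3^ D Q s 3∤D (∣ₚ-cancel-3 D (+ (3 ℕ.^ s) ·ₚ Q) 3∤D (∣ₚ-respʳ-≈ D _ _ D∣3^[1+s]Q (begin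
      + (3 ℕ.* 3 ℕ.^ s) ·ₚ Q        ≡⟨ cong (_·ₚ Q) (ℤ.pos-* 3 (3 ℕ.^ s)) ⟩
      (+ 3 * + (3 ℕ.^ s)) ·ₚ Q      ≈⟨ ·ₚ-·ₚ (+ 3) (+ (3 ℕ.^ s)) Q ⟨
      + 3 ·ₚ (+ (3 ℕ.^ s) ·ₚ Q)     ∎)))

  -- Coprimality in ℤ[1/3][x].
  record Coprime₃ (A B : Poly) : Set where
    constructor coprime₃
    field
      exponent : ℕ
      u v      : Poly
      bezout   : u *ₚ A +ₚ v *ₚ B ≈ + (3 ℕ.^ exponent) ∷ []

  Coprime₃-sym : ∀ {A B} → Coprime₃ A B → Coprime₃ B A
  Coprime₃-sym {A} {B} (coprime₃ s u v bezout) = coprime₃ s v u (≈-trans (+ₚ-comm (v *ₚ B) (u *ₚ A)) bezout)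

  Coprime₃-oneₚ : ∀ A → Coprime₃ A oneₚ
  Coprime₃-oneₚ A = coprime₃ 0 [] oneₚ (*ₚ-identityˡ oneₚ)

  Coprime₃-*ₚ : ∀ {A B C} → Coprime₃ A B → Coprime₃ A C → Coprime₃ A (B *ₚ C)
  Coprime₃-*ₚ {A} {B} {C} (coprime₃ s u v bezout) (coprime₃ s′ u′ v′ bezout′) =
    coprime₃ (s ℕ.+ s′) ((u *ₚ u′) *ₚ A +ₚ (u *ₚ v′) *ₚ C +ₚ (v *ₚ u′) *ₚ B) (v *ₚ v′) (begin
      ((u *ₚ u′) *ₚ A +ₚ (u *ₚ v′) *ₚ C +ₚ (v *ₚ u′) *ₚ B) *ₚ A +ₚ (v *ₚ v′) *ₚ (B *ₚ C)
        ≈⟨ solve 7 (λ u v u′ v′ A B C →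
             (((u ⊗ u′) ⊗ A ⊕ (u ⊗ v′) ⊗ C ⊕ (v ⊗ u′) ⊗ B) ⊗ A ⊕ (v ⊗ v′) ⊗ (B ⊗ C))
               ⊜ ((u ⊗ A ⊕ v ⊗ B) ⊗ (u′ ⊗ A ⊕ v′ ⊗ C))) ≈-refl u v u′ v′ A B C ⟩
      (u *ₚ A +ₚ v *ₚ B) *ₚ (u′ *ₚ A +ₚ v′ *ₚ C)
        ≈⟨ *ₚ-cong bezout bezout′ ⟩
      (+ (3 ℕ.^ s) ∷ []) *ₚ (+ (3 ℕ.^ s′) ∷ [])
        ≈⟨ *ₚ-const (+ (3 ℕ.^ s) ∷ []) (+ (3 ℕ.^ s′)) ⟩
      (+ (3 ℕ.^ s′) * + (3 ℕ.^ s)) ∷ []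
        ≡⟨ cong (_∷ []) (trans (ℤ.*-comm (+ (3 ℕ.^ s′)) _)
             (trans (sym (ℤ.pos-* (3 ℕ.^ s) (3 ℕ.^ s′))) (cong +_ (sym (ℕ.^-distribˡ-+-* 3 s s′))))) ⟩
      + (3 ℕ.^ (s ℕ.+ s′)) ∷ []
        ∎)

  Coprime₃-^ₚ : ∀ {A B} k → Coprime₃ A B → Coprime₃ A (B ^ₚ k)
  Coprime₃-^ₚ zero    A⊥B = Coprime₃-oneₚ _
  Coprime₃-^ₚ (suc k) A⊥B = Coprime₃-*ₚ A⊥B (Coprime₃-^ₚ k A⊥B)

  Coprime₃-∣ʳ : ∀ {A B C} → Coprime₃ A B → C ∣ₚ B → Coprime₃ A C
  Coprime₃-∣ʳ {A} {B} {C} (coprime₃ s u v bezout) (W , CW≈B) = coprime₃ s u (v *ₚ W) (begin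
    u *ₚ A +ₚ (v *ₚ W) *ₚ C
      ≈⟨ +ₚ-cong (≈-refl {u *ₚ A}) (solve 3 (λ v W C → (v ⊗ W) ⊗ C ⊜ v ⊗ (C ⊗ W)) ≈-refl v W C) ⟩
    u *ₚ A +ₚ v *ₚ (C *ₚ W)
      ≈⟨ +ₚ-cong (≈-refl {u *ₚ A}) (*ₚ-congˡ v (mk≈ {C *ₚ W} CW≈B)) ⟩
    u *ₚ A +ₚ v *ₚ B
      ≈⟨ bezout ⟩
    + (3 ℕ.^ s) ∷ []
      ∎)

  ∣ₚ-cancel-Coprime₃ : ∀ D Q {A B} → ¬ 3∣ₚ D → D ∣ₚ Q *ₚ A → D ∣ₚ Q *ₚ B → Coprime₃ A B → D ∣ₚ Q
  ∣ₚ-cancel-Coprime₃ D Q {A} {B} 3∤D (R , DR≈QA) (R′ , DR′≈QB) (coprime₃ s u v bezout) =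
    ∣ₚ-cancel-3^ D Q s 3∤D (u *ₚ R +ₚ v *ₚ R′ , at (begin
      D *ₚ (u *ₚ R +ₚ v *ₚ R′)
        ≈⟨ solve 5 (λ D u v R R′ → D ⊗ (u ⊗ R ⊕ v ⊗ R′) ⊜ (u ⊗ (D ⊗ R) ⊕ v ⊗ (D ⊗ R′))) ≈-refl D u v R R′ ⟩
      u *ₚ (D *ₚ R) +ₚ v *ₚ (D *ₚ R′)
        ≈⟨ +ₚ-cong (*ₚ-congˡ u (mk≈ {D *ₚ R} DR≈QA)) (*ₚ-congˡ v (mk≈ {D *ₚ R′} DR′≈QB)) ⟩
      u *ₚ (Q *ₚ A) +ₚ v *ₚ (Q *ₚ B)
        ≈⟨ solve 5 (λ Q u v A B → (u ⊗ (Q ⊗ A) ⊕ v ⊗ (Q ⊗ B)) ⊜ Q ⊗ (u ⊗ A ⊕ v ⊗ B)) ≈-refl Q u v A B ⟩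
      Q *ₚ (u *ₚ A +ₚ v *ₚ B)            ≈⟨ *ₚ-congˡ Q bezout ⟩
      Q *ₚ (+ (3 ℕ.^ s) ∷ [])            ≈⟨ *ₚ-const Q (+ (3 ℕ.^ s)) ⟩
      + (3 ℕ.^ s) ·ₚ Q                   ∎))

module TailSums where

  open import Data.Nat using (ℕ; zero; suc; _+_; _∸_; _≤_; _<_; _≤?_; _≟_)
  open import Data.Nat.Properties
  open import Data.Bool using (if_then_else_; true; false)
  open import Data.Sum using (inj₁; inj₂)
  open import Data.List using (_∷_; filter; length)
  open import Relation.Nullary using (Dec; yes; no; does; ¬_)
  open import Relation.Nullary.Decidable using (dec-true; dec-false)
  open import Relation.Unary using (Pred; Decidable)
  open import Relation.Binary.PropositionalEquality
  open import Data.Nat.Tactic.RingSolver using (solve-∀)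

  when : ∀ {p} {P : Set p} → Dec P → ℕ → ℕ
  when P? n = if does P? then n else 0

  when-yes : ∀ {p} {P : Set p} (P? : Dec P) n → P → when P? n ≡ n
  when-yes P? n p rewrite dec-true P? p = refl

  when-no : ∀ {p} {P : Set p} (P? : Dec P) n → ¬ P → when P? n ≡ 0
  when-no P? n ¬p rewrite dec-false P? ¬p = refl

  when-0 : ∀ {p} {P : Set p} (P? : Dec P) → when P? 0 ≡ 0
  when-0 P? with does P?
  ... | true  = refl
  ... | false = refl

  when-+ : ∀ {p} {P : Set p} (P? : Dec P) m n → when P? (m + n) ≡ when P? m + when P? n
  when-+ P? m n with does P?
  ... | true  = refl
  ... | false = refl

  when-⇔ : ∀ {p q} {P : Set p} {Q : Set q} (P? : Dec P) (Q? : Dec Q) n →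
           (P → Q) → (Q → P) → when P? n ≡ when Q? n
  when-⇔ (yes p) (yes q) n P→Q Q→P = refl
  when-⇔ (no ¬p) (no ¬q) n P→Q Q→P = refl
  when-⇔ (yes p) (no ¬q) n P→Q Q→P with () ← ¬q (P→Q p)
  when-⇔ (no ¬p) (yes q) n P→Q Q→P with () ← ¬p (Q→P q)

  length-filter-∷ : ∀ {a p} {A : Set a} {P : Pred A p} (P? : Decidable P) x xs →
                    length (filter P? (x ∷ xs)) ≡ when (P? x) 1 + length (filter P? xs)
  length-filter-∷ P? x xs with does (P? x)
  ... | true  = refl
  ... | false = refl

  tailSum : ℕ → (ℕ → ℕ) → ℕ → ℕ
  tailSum zero    c j = 0
  tailSum (suc K) c j = when (j ≤? K) (c K) + tailSum K c j

  tailSum-cong : ∀ K {c d} j → (∀ k → k < K → c k ≡ d k) → tailSum K c j ≡ tailSum K d j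
  tailSum-cong zero    j c≡d = refl
  tailSum-cong (suc K) j c≡d =
    cong₂ (λ u v → when (j ≤? K) u + v) (c≡d K ≤-refl) (tailSum-cong K j (λ k k<K → c≡d k (m≤n⇒m≤1+n k<K)))

  tailSum-+ : ∀ K c d j → tailSum K (λ k → c k + d k) j ≡ tailSum K c j + tailSum K d j
  tailSum-+ zero    c d j = refl
  tailSum-+ (suc K) c d j = begin
    when (j ≤? K) (c K + d K) + tailSum K (λ k → c k + d k) j
      ≡⟨ cong₂ _+_ (when-+ (j ≤? K) (c K) (d K)) (tailSum-+ K c d j) ⟩
    (when (j ≤? K) (c K) + when (j ≤? K) (d K)) + (tailSum K c j + tailSum K d j)
      ≡⟨ interchange (when (j ≤? K) (c K)) (when (j ≤? K) (d K)) (tailSum K c j) (tailSum K d j) ⟩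
    (when (j ≤? K) (c K) + tailSum K c j) + (when (j ≤? K) (d K) + tailSum K d j)
      ∎
    where
    open ≡-Reasoning
    interchange : ∀ a b x y → (a + b) + (x + y) ≡ (a + x) + (b + y)
    interchange = solve-∀

  tailSum-≥ : ∀ K c {j} → K ≤ j → tailSum K c j ≡ 0
  tailSum-≥ zero    c K≤j = refl
  tailSum-≥ (suc K) c K<j = cong₂ _+_ (when-no (_ ≤? K) (c K) (<⇒≱ K<j)) (tailSum-≥ K c (<⇒≤ K<j))

  tailSum-0 : ∀ K j → tailSum K (λ _ → 0) j ≡ 0
  tailSum-0 zero    j = refl
  tailSum-0 (suc K) j = cong₂ _+_ (when-0 (j ≤? K)) (tailSum-0 K j)

  ≤-tailSum : ∀ K c {j} → j < K → c j ≤ tailSum K c j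
  ≤-tailSum (suc K) c {j} j<1+K with m≤n⇒m<n∨m≡n (≤-pred j<1+K)
  ... | inj₂ refl = ≤-trans (≤-reflexive (sym (when-yes (j ≤? j) (c j) ≤-refl))) (m≤m+n _ _)
  ... | inj₁ j<K  = ≤-trans (≤-tailSum K c j<K) (m≤n+m _ _)

  tailSum-indicator : ∀ K {i} j → i < K → tailSum K (λ k → when (i ≟ k) 1) j ≡ when (j ≤? i) 1
  tailSum-indicator (suc K) {i} j i<1+K with m≤n⇒m<n∨m≡n (≤-pred i<1+K)
  ... | inj₂ refl = begin
    when (j ≤? i) (when (i ≟ i) 1) + tailSum i (λ k → when (i ≟ k) 1) j
      ≡⟨ cong₂ (λ u v → when (j ≤? i) u + v) (when-yes (i ≟ i) 1 refl)
           (tailSum-cong i j (λ k k<i → when-no (i ≟ k) 1 (>⇒≢ k<i))) ⟩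
    when (j ≤? i) 1 + tailSum i (λ _ → 0) j
      ≡⟨ cong (when (j ≤? i) 1 +_) (tailSum-0 i j) ⟩
    when (j ≤? i) 1 + 0
      ≡⟨ +-identityʳ _ ⟩
    when (j ≤? i) 1
      ∎
    where open ≡-Reasoning
  ... | inj₁ i<K = begin
    when (j ≤? K) (when (i ≟ K) 1) + tailSum K (λ k → when (i ≟ k) 1) j
      ≡⟨ cong₂ (λ u v → when (j ≤? K) u + v) (when-no (i ≟ K) 1 (<⇒≢ i<K)) (tailSum-indicator K j i<K) ⟩
    when (j ≤? K) 0 + when (j ≤? i) 1
      ≡⟨ cong (_+ when (j ≤? i) 1) (when-0 (j ≤? K)) ⟩
    when (j ≤? i) 1
      ∎
    where open ≡-Reasoning

  ∸-+-∸ : ∀ {a b c} → c ≤ b → b ≤ a → (a ∸ b) + (b ∸ c) ≡ a ∸ c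
  ∸-+-∸ {a} {b} {c} c≤b b≤a = +-cancelʳ-≡ c _ _ (begin
    (a ∸ b) + (b ∸ c) + c     ≡⟨ +-assoc (a ∸ b) (b ∸ c) c ⟩
    (a ∸ b) + ((b ∸ c) + c)   ≡⟨ cong ((a ∸ b) +_) (m∸n+n≡m c≤b) ⟩
    (a ∸ b) + b               ≡⟨ m∸n+n≡m b≤a ⟩
    a                         ≡⟨ m∸n+n≡m (≤-trans c≤b b≤a) ⟨
    (a ∸ c) + c               ∎)
    where open ≡-Reasoning

module CyclotomicFactors where

  open PolynomialRing
  open PolynomialProperties
  open ThreeAdic
  open TailSums

  open import Data.Nat as ℕ using (ℕ; zero; suc; _≤_; _<_; _≟_; z≤n; s≤s)
  import Data.Nat.Properties as ℕ
  open import Data.Integer as ℤ using (_+_; _*_; +_; 0ℤ; 1ℤ; -1ℤ)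
  import Data.Integer.Properties as ℤ
  open import Data.Product using (_,_; ∃; proj₂)
  open import Data.Empty using (⊥-elim)
  open import Data.Sum using (inj₁; inj₂)
  open import Relation.Nullary using (yes; no; ¬_)
  open import Relation.Binary.Definitions using (tri<; tri≈; tri>)
  open import Relation.Binary.PropositionalEquality
  open ≈-Reasoning

  x^3^ : ℕ → Poly
  x^3^ k = monomial (3 ℕ.^ k)

  -- Φ k is the cyclotomic polynomial Φ_{2·3^k}; onePlusX3k k = ∏_{i ≤ k} Φ i.
  Φ : ℕ → Poly
  Φ zero    = onePlusX3k 0
  Φ (suc k) = oneₚ +ₚ negₚ (x^3^ k) +ₚ x^3^ k *ₚ x^3^ k

  x^3^-suc : ∀ k → x^3^ (suc k) ≈ x^3^ k *ₚ (x^3^ k *ₚ x^3^ k)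
  x^3^-suc k = begin
    monomial (3 ℕ.^ k ℕ.+ (3 ℕ.^ k ℕ.+ (3 ℕ.^ k ℕ.+ 0)))
      ≈⟨ monomial-+ (3 ℕ.^ k) _ ⟩
    x^3^ k *ₚ monomial (3 ℕ.^ k ℕ.+ (3 ℕ.^ k ℕ.+ 0))
      ≈⟨ *ₚ-congˡ (x^3^ k) (monomial-+ (3 ℕ.^ k) _) ⟩
    x^3^ k *ₚ (x^3^ k *ₚ monomial (3 ℕ.^ k ℕ.+ 0))
      ≡⟨ cong (λ d → x^3^ k *ₚ (x^3^ k *ₚ monomial d)) (ℕ.+-identityʳ (3 ℕ.^ k)) ⟩
    x^3^ k *ₚ (x^3^ k *ₚ x^3^ k)
      ∎

  onePlusX3k-suc : ∀ k → onePlusX3k (suc k) ≈ onePlusX3k k *ₚ Φ (suc k)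
  onePlusX3k-suc k = begin
    oneₚ +ₚ x^3^ (suc k)
      ≈⟨ +ₚ-cong (≈-refl {oneₚ}) (x^3^-suc k) ⟩
    oneₚ +ₚ x^3^ k *ₚ (x^3^ k *ₚ x^3^ k)
      ≈⟨ solve 1 (λ y → Κ oneₚ ⊕ y ⊗ (y ⊗ y) ⊜ (Κ oneₚ ⊕ y) ⊗ (Κ oneₚ ⊕ ⊝ y ⊕ y ⊗ y)) ≈-refl (x^3^ k) ⟩
    (oneₚ +ₚ x^3^ k) *ₚ Φ (suc k)
      ∎

  Φ-∣-onePlusX3k : ∀ {i k} → i ≤ k → Φ i ∣ₚ onePlusX3k k
  Φ-∣-onePlusX3k {zero}  {zero}  z≤n = oneₚ , at (*ₚ-identityʳ (Φ 0))
  Φ-∣-onePlusX3k {i}     {suc k} i≤1+k with ℕ.m≤n⇒m<n∨m≡n i≤1+k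
  ... | inj₂ refl  = onePlusX3k k , at (≈-trans (*ₚ-comm (Φ (suc k)) (onePlusX3k k)) (≈-sym (onePlusX3k-suc k)))
  ... | inj₁ i<1+k = ∣ₚ-respʳ-≈ (Φ i) _ _
                       (∣ₚ-*ₚʳ (Φ i) (onePlusX3k k) (Φ (suc k)) (Φ-∣-onePlusX3k (ℕ.≤-pred i<1+k)))
                       (≈-sym (onePlusX3k-suc k))

  -- Φ (k+1) − (x^{3^k} − 2) · (1 + x^{3^k}) = 3.
  Coprime₃-Φ-onePlusX3k : ∀ k → Coprime₃ (Φ (suc k)) (onePlusX3k k)
  Coprime₃-Φ-onePlusX3k k = coprime₃ 1 oneₚ (negₚ (x^3^ k +ₚ negₚ (oneₚ +ₚ oneₚ)))
    (solve 1 (λ y → Κ oneₚ ⊗ (Κ oneₚ ⊕ ⊝ y ⊕ y ⊗ y) ⊕ (⊝ (y ⊕ ⊝ (Κ oneₚ ⊕ Κ oneₚ))) ⊗ (Κ oneₚ ⊕ y)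
                      ⊜ (Κ oneₚ ⊕ Κ oneₚ ⊕ Κ oneₚ)) ≈-refl (x^3^ k))

  Coprime₃-Φ : ∀ {i j} → i ≢ j → Coprime₃ (Φ i) (Φ j)
  Coprime₃-Φ {i} {j} i≢j with ℕ.<-cmp i j
  ... | tri≈ _ i≡j _ = ⊥-elim (i≢j i≡j)
  Coprime₃-Φ {i} {suc k} i≢j | tri< (s≤s i≤k) _ _ =
    Coprime₃-sym (Coprime₃-∣ʳ (Coprime₃-Φ-onePlusX3k k) (Φ-∣-onePlusX3k i≤k))
  Coprime₃-Φ {suc k} {j} i≢j | tri> _ _ (s≤s j≤k) =
    Coprime₃-∣ʳ (Coprime₃-Φ-onePlusX3k k) (Φ-∣-onePlusX3k j≤k)

  ∏Φ^ : ℕ → (ℕ → ℕ) → Poly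
  ∏Φ^ zero    e = oneₚ
  ∏Φ^ (suc B) e = Φ B ^ₚ e B *ₚ ∏Φ^ B e

  ∏Φ^-cong : ∀ B {e f} → (∀ j → j < B → e j ≡ f j) → ∏Φ^ B e ≡ ∏Φ^ B f
  ∏Φ^-cong zero    e≡f = refl
  ∏Φ^-cong (suc B) e≡f =
    cong₂ (λ u v → Φ B ^ₚ u *ₚ v) (e≡f B ℕ.≤-refl) (∏Φ^-cong B (λ j j<B → e≡f j (ℕ.m≤n⇒m≤1+n j<B)))

  ∏Φ^-*ₚ : ∀ B e f → ∏Φ^ B e *ₚ ∏Φ^ B f ≈ ∏Φ^ B (λ j → e j ℕ.+ f j)
  ∏Φ^-*ₚ zero    e f = *ₚ-identityˡ oneₚ
  ∏Φ^-*ₚ (suc B) e f = begin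
    (Φ B ^ₚ e B *ₚ ∏Φ^ B e) *ₚ (Φ B ^ₚ f B *ₚ ∏Φ^ B f)
      ≈⟨ solve 4 (λ a b c d → (a ⊗ b) ⊗ (c ⊗ d) ⊜ (a ⊗ c) ⊗ (b ⊗ d)) ≈-refl
           (Φ B ^ₚ e B) (∏Φ^ B e) (Φ B ^ₚ f B) (∏Φ^ B f) ⟩
    (Φ B ^ₚ e B *ₚ Φ B ^ₚ f B) *ₚ (∏Φ^ B e *ₚ ∏Φ^ B f)
      ≈⟨ *ₚ-cong (≈-sym (^ₚ-+ (Φ B) (e B) (f B))) (∏Φ^-*ₚ B e f) ⟩
    Φ B ^ₚ (e B ℕ.+ f B) *ₚ ∏Φ^ B (λ j → e j ℕ.+ f j)
      ∎

  ∏Φ^-suc : ∀ B e → e B ≡ 0 → ∏Φ^ (suc B) e ≈ ∏Φ^ B e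
  ∏Φ^-suc B e eB≡0 rewrite eB≡0 = *ₚ-identityˡ (∏Φ^ B e)

  onePlusX3k^≈∏Φ^ : ∀ k c → onePlusX3k k ^ₚ c ≈ ∏Φ^ (suc k) (λ _ → c)
  onePlusX3k^≈∏Φ^ zero    c = ≈-sym (*ₚ-identityʳ (Φ 0 ^ₚ c))
  onePlusX3k^≈∏Φ^ (suc k) c = begin
    onePlusX3k (suc k) ^ₚ c                   ≈⟨ ^ₚ-congˡ c (onePlusX3k-suc k) ⟩
    (onePlusX3k k *ₚ Φ (suc k)) ^ₚ c          ≈⟨ ^ₚ-distrib-*ₚ (onePlusX3k k) (Φ (suc k)) c ⟩
    onePlusX3k k ^ₚ c *ₚ Φ (suc k) ^ₚ c       ≈⟨ *ₚ-comm (onePlusX3k k ^ₚ c) _ ⟩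
    Φ (suc k) ^ₚ c *ₚ onePlusX3k k ^ₚ c       ≈⟨ *ₚ-congˡ (Φ (suc k) ^ₚ c) (onePlusX3k^≈∏Φ^ k c) ⟩
    Φ (suc k) ^ₚ c *ₚ ∏Φ^ (suc k) (λ _ → c)   ∎

  Coprime₃-Φ-∏Φ^ : ∀ {m} B e → e m ≡ 0 → Coprime₃ (Φ m) (∏Φ^ B e)
  Coprime₃-Φ-∏Φ^         zero    e em≡0 = Coprime₃-oneₚ _
  Coprime₃-Φ-∏Φ^ {m} (suc B) e em≡0 = Coprime₃-*ₚ Φm⊥ΦB^ (Coprime₃-Φ-∏Φ^ B e em≡0)
    where
    Φm⊥ΦB^ : Coprime₃ (Φ m) (Φ B ^ₚ e B)
    Φm⊥ΦB^ with m ≟ B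
    ... | yes refl rewrite em≡0 = Coprime₃-oneₚ (Φ m)
    ... | no m≢B   = Coprime₃-^ₚ (e B) (Coprime₃-Φ m≢B)

  Coprime₃-Φ^-∏Φ^ : ∀ {m} k B e → e m ≡ 0 → Coprime₃ (Φ m ^ₚ k) (∏Φ^ B e)
  Coprime₃-Φ^-∏Φ^ k B e em≡0 = Coprime₃-sym (Coprime₃-^ₚ k (Coprime₃-sym (Coprime₃-Φ-∏Φ^ B e em≡0)))

  -- Peel the factors Φ m ^ e m off ∏Φ^ B (c 0) from the top; each is coprime to ∏Φ^ B (c m) up to 3.
  ∣ₚ-∏Φ^-cancel : ∀ D G B (c : ℕ → ℕ → ℕ) → ¬ 3∣ₚ D → 0 < B →
                  (∀ m → m < B → c m m ≡ 0) → (∀ m → m < B → D ∣ₚ G *ₚ ∏Φ^ B (c m)) → D ∣ₚ G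
  ∣ₚ-∏Φ^-cancel D G B c 3∤D 0<B cmm≡0 D∣G∏c = peel B (c 0) ℕ.≤-refl (D∣G∏c 0 0<B)
    where
    peel : ∀ m e → m ≤ B → D ∣ₚ G *ₚ ∏Φ^ m e → D ∣ₚ G
    peel zero    e _   D∣G1 = ∣ₚ-respʳ-≈ D _ G D∣G1 (*ₚ-identityʳ G)
    peel (suc m) e m<B D∣G∏e = peel m e (ℕ.<⇒≤ m<B)
      (∣ₚ-cancel-Coprime₃ D (G *ₚ ∏Φ^ m e) 3∤D D∣QA D∣QB (Coprime₃-Φ^-∏Φ^ (e m) B (c m) (cmm≡0 m m<B)))
      where
      D∣QA : D ∣ₚ (G *ₚ ∏Φ^ m e) *ₚ Φ m ^ₚ e m
      D∣QA = ∣ₚ-respʳ-≈ D _ _ D∣G∏e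
        (solve 3 (λ G A P → G ⊗ (A ⊗ P) ⊜ (G ⊗ P) ⊗ A) ≈-refl G (Φ m ^ₚ e m) (∏Φ^ m e))
      D∣QB : D ∣ₚ (G *ₚ ∏Φ^ m e) *ₚ ∏Φ^ B (c m)
      D∣QB = ∣ₚ-respʳ-≈ D _ _ (∣ₚ-*ₚʳ D (G *ₚ ∏Φ^ B (c m)) (∏Φ^ m e) (D∣G∏c m m<B))
        (solve 3 (λ G C P → (G ⊗ C) ⊗ P ⊜ (G ⊗ P) ⊗ C) ≈-refl G (∏Φ^ B (c m)) (∏Φ^ m e))

  Monic-Φ : ∀ k → ∃ λ d → Monic d (Φ k)
  Monic-Φ zero    = 1 , monic refl λ { zero () ; (suc zero) (s≤s ()) ; (suc (suc i)) _ → refl }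
  Monic-Φ (suc k) = d , Monic-resp-≈ (+ₚ-cong (≈-refl {1-y}) (monomial-+ (3 ℕ.^ k) (3 ℕ.^ k)))
                                     (Monic-+ₚ-lower 1-y 1-y-low (Monic-monomial d))
    where
    d : ℕ
    d = 3 ℕ.^ k ℕ.+ 3 ℕ.^ k
    1-y : Poly
    1-y = oneₚ +ₚ negₚ (x^3^ k)
    3^k<d : 3 ℕ.^ k < d
    3^k<d = ℕ.m<m+n (3 ℕ.^ k) (ℕ.m^n>0 3 k)
    1-y-low : ∀ i → d ≤ i → coeff 1-y i ≡ 0ℤ
    1-y-low zero    d≤0 = ⊥-elim (ℕ.<⇒≱ (ℕ.m^n>0 3 k) (ℕ.≤-trans (ℕ.m≤m+n (3 ℕ.^ k) (3 ℕ.^ k)) d≤0))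
    1-y-low (suc i) d≤i = trans (coeff-+ₚ oneₚ (negₚ (x^3^ k)) (suc i)) (trans (ℤ.+-identityˡ _)
      (trans (coeff-·ₚ -1ℤ (x^3^ k) (suc i)) (cong (-1ℤ *_) (coeff-monomial-≢ (ℕ.<⇒≢ (ℕ.<-≤-trans 3^k<d d≤i))))))

  Monic-∏Φ^ : ∀ B e → ∃ λ d → Monic d (∏Φ^ B e)
  Monic-∏Φ^ zero    e = 0 , Monic-oneₚ
  Monic-∏Φ^ (suc B) e with Monic-Φ B | Monic-∏Φ^ B e
  ... | _ , monic-Φ | _ , monic-∏ = _ , Monic-*ₚ (Monic-^ₚ (e B) monic-Φ) monic-∏

  LeadPos-∏Φ^ : ∀ B e → LeadPos (∏Φ^ B e)
  LeadPos-∏Φ^ B e = Monic⇒LeadPos (proj₂ (Monic-∏Φ^ B e))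

  eval-Φ-suc : ∀ k → eval (Φ (suc k)) 1ℤ ≡ 1ℤ
  eval-Φ-suc k = trans (eval-+ₚ (oneₚ +ₚ negₚ y) (y *ₚ y) 1ℤ) (cong₂ _+_
    (trans (eval-+ₚ oneₚ (negₚ y) 1ℤ) (cong (λ z → 1ℤ + z) (trans (eval-·ₚ -1ℤ y 1ℤ) (cong (-1ℤ *_) y[1]≡1))))
    (trans (eval-*ₚ y y 1ℤ) (cong₂ _*_ y[1]≡1 y[1]≡1)))
    where
    y : Poly
    y = x^3^ k
    y[1]≡1 : eval y 1ℤ ≡ 1ℤ
    y[1]≡1 = trans (eval-monomial (3 ℕ.^ k) 1ℤ) (ℤ.^-zeroˡ (3 ℕ.^ k))

  eval-∏Φ^ : ∀ B e → eval (∏Φ^ (suc B) e) 1ℤ ≡ + (2 ℕ.^ e 0)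
  eval-∏Φ^ zero    e = trans (eval-*ₚ (Φ 0 ^ₚ e 0) oneₚ 1ℤ)
    (trans (ℤ.*-identityʳ _) (trans (eval-^ₚ (Φ 0) (e 0) 1ℤ) (pos-^ 2 (e 0))))
  eval-∏Φ^ (suc B) e = trans (eval-*ₚ (Φ (suc B) ^ₚ e (suc B)) (∏Φ^ (suc B) e) 1ℤ)
    (trans (cong₂ _*_ Φ^[1]≡1 (eval-∏Φ^ B e)) (ℤ.*-identityˡ _))
    where
    Φ^[1]≡1 : eval (Φ (suc B) ^ₚ e (suc B)) 1ℤ ≡ 1ℤ
    Φ^[1]≡1 = trans (eval-^ₚ (Φ (suc B)) (e (suc B)) 1ℤ)
      (trans (cong (ℤ._^ e (suc B)) (eval-Φ-suc B)) (ℤ.^-zeroˡ (e (suc B))))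

module TernaryPartitions where

  open TailSums

  open import Data.Nat using (ℕ; zero; suc; _+_; _*_; _^_; _∸_; _≤_; _<_; _≥_; _≤?_; _≟_; z≤n; s≤s)
  open import Data.Nat.Properties
  open import Data.Nat.ListAction.Properties using (sum-++)
  open import Data.List using (List; []; _∷_; _++_; replicate; filter; length)
  open import Data.List.Properties using (length-replicate; filter-all; filter-none; filter-++; length-++)
  open import Data.List.Relation.Unary.All as All using (All; []; _∷_)
  open import Data.List.Relation.Unary.All.Properties using (replicate⁺; ++⁺)
  open import Data.Product using (∃; _×_; _,_)
  open import Data.List.Relation.Unary.Linked using (Linked; []; [-]; _∷_)
  open import Relation.Nullary using (Dec; yes; no)
  open import Data.Empty using (⊥-elim)
  open import Relation.Binary.PropositionalEquality

  n<3^n : ∀ n → n < 3 ^ n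
  n<3^n zero    = s≤s z≤n
  n<3^n (suc n) = ≤-trans (s≤s (n<3^n n))
    (≤-trans (+-monoˡ-≤ (3 ^ n) (m^n>0 3 n)) (+-monoʳ-≤ (3 ^ n) (m≤m+n (3 ^ n) _)))

  3^-≤-reflect : ∀ {i j} → 3 ^ i ≤ 3 ^ j → i ≤ j
  3^-≤-reflect {i} {j} 3^i≤3^j with i ≤? j
  ... | yes i≤j = i≤j
  ... | no  i≰j = ⊥-elim (<⇒≱ (^-monoʳ-< 3 (s≤s (s≤s z≤n)) (≰⇒> i≰j)) 3^i≤3^j)

  3^-injective : ∀ {i j} → 3 ^ i ≡ 3 ^ j → i ≡ j
  3^-injective e = ≤-antisym (3^-≤-reflect (≤-reflexive e)) (3^-≤-reflect (≤-reflexive (sym e)))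

  sum-replicate : ∀ a v → sumℕ (replicate a v) ≡ a * v
  sum-replicate zero    v = refl
  sum-replicate (suc a) v = cong (v +_) (sum-replicate a v)

  Linked-replicate : ∀ a v → Linked _≥_ (replicate a v)
  Linked-replicate zero          v = []
  Linked-replicate (suc zero)    v = [-]
  Linked-replicate (suc (suc a)) v = ≤-refl ∷ Linked-replicate (suc a) v

  Linked-++-ones : ∀ {xs} r → Linked _≥_ xs → All (1 ≤_) xs → Linked _≥_ (xs ++ replicate r 1)
  Linked-++-ones {[]}         r _          _             = Linked-replicate r 1
  Linked-++-ones {x ∷ []}     zero    _    _             = [-]
  Linked-++-ones {x ∷ []}     (suc r) _    (1≤x ∷ _)     = 1≤x ∷ Linked-replicate (suc r) 1
  Linked-++-ones {x ∷ y ∷ xs} r (x≥y ∷ l) (_ ∷ 1≤ys)  = x≥y ∷ Linked-++-ones r l 1≤ys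

  pow3-positive : ∀ {xs} → All IsPow3 xs → All (1 ≤_) xs
  pow3-positive = All.map λ { (i , refl) → m^n>0 3 i }

  parts≤n : ∀ {n λ′} → IsTernaryPartition n λ′ → All (_≤ n) λ′
  parts≤n {λ′ = λ′} (_ , _ , sum≡n) = subst (λ s → All (_≤ s) λ′) sum≡n (≤-sum λ′)
    where
    ≤-sum : ∀ xs → All (_≤ sumℕ xs) xs
    ≤-sum []       = []
    ≤-sum (x ∷ xs) = m≤m+n x (sumℕ xs) ∷ All.map (λ x≤ → ≤-trans x≤ (m≤n+m (sumℕ xs) x)) (≤-sum xs)

  ++-ones-ternary : ∀ {s xs} n → IsTernaryPartition s xs → s ≤ n → IsTernaryPartition n (xs ++ replicate (n ∸ s) 1)
  ++-ones-ternary {s} {xs} n (linked , pow3 , sum≡s) s≤n =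
    Linked-++-ones (n ∸ s) linked (pow3-positive pow3) ,
    ++⁺ pow3 (replicate⁺ (n ∸ s) (0 , refl)) ,
    (begin
      sumℕ (xs ++ replicate (n ∸ s) 1)          ≡⟨ sum-++ xs (replicate (n ∸ s) 1) ⟩
      sumℕ xs + sumℕ (replicate (n ∸ s) 1)      ≡⟨ cong₂ _+_ sum≡s (trans (sum-replicate (n ∸ s) 1) (*-identityʳ (n ∸ s))) ⟩
      s + (n ∸ s)                               ≡⟨ m+[n∸m]≡n s≤n ⟩
      n                                         ∎)
    where open ≡-Reasoning

  Part : ℕ → ℕ → Set
  Part n p = ∃ λ i → p ≡ 3 ^ i × i < suc n

  parts : ∀ {n λ′} → IsTernaryPartition n λ′ → All (Part n) λ′
  parts {n} ternary@(_ , pow3 , _) = All.zipWith part (pow3 , parts≤n ternary)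
    where
    part : ∀ {p} → IsPow3 p × p ≤ n → Part n p
    part ((i , refl) , 3^i≤n) = i , refl , s≤s (<⇒≤ (<-≤-trans (n<3^n i) 3^i≤n))

  #parts≥3^ : ℕ → List ℕ → ℕ
  #parts≥3^ j λ′ = length (filter (3 ^ j ≤?_) λ′)

  #parts≥3^-* : ∀ j λ′ → #parts≥3^ j λ′ * 3 ^ j ≤ sumℕ λ′
  #parts≥3^-* j []        = z≤n
  #parts≥3^-* j (p ∷ λ′) = begin
    #parts≥3^ j (p ∷ λ′) * 3 ^ j                             ≡⟨ cong (_* 3 ^ j) (length-filter-∷ (3 ^ j ≤?_) p λ′) ⟩
    (when (3 ^ j ≤? p) 1 + #parts≥3^ j λ′) * 3 ^ j          ≡⟨ *-distribʳ-+ (3 ^ j) (when (3 ^ j ≤? p) 1) _ ⟩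
    when (3 ^ j ≤? p) 1 * 3 ^ j + #parts≥3^ j λ′ * 3 ^ j    ≤⟨ +-mono-≤ (head (3 ^ j ≤? p)) (#parts≥3^-* j λ′) ⟩
    p + sumℕ λ′                                              ∎
    where
    open ≤-Reasoning
    head : (3^j≤?p : Dec (3 ^ j ≤ p)) → when 3^j≤?p 1 * 3 ^ j ≤ p
    head (yes 3^j≤p) = ≤-trans (≤-reflexive (+-identityʳ (3 ^ j))) 3^j≤p
    head (no  _)     = z≤n

  tailSum-mult : ∀ {n λ′} → All (Part n) λ′ → ∀ j → tailSum (suc n) (λ k → mult λ′ (3 ^ k)) j ≡ #parts≥3^ j λ′
  tailSum-mult {n} []                        j = tailSum-0 (suc n) j
  tailSum-mult {n} {_ ∷ λ′} ((i , refl , i≤n) ∷ ps) j = begin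
    tailSum (suc n) (λ k → mult (3 ^ i ∷ λ′) (3 ^ k)) j
      ≡⟨ tailSum-cong (suc n) j (λ k _ → length-filter-∷ (_≟ 3 ^ k) (3 ^ i) λ′) ⟩
    tailSum (suc n) (λ k → when (3 ^ i ≟ 3 ^ k) 1 + mult λ′ (3 ^ k)) j
      ≡⟨ tailSum-+ (suc n) (λ k → when (3 ^ i ≟ 3 ^ k) 1) _ j ⟩
    tailSum (suc n) (λ k → when (3 ^ i ≟ 3 ^ k) 1) j + tailSum (suc n) (λ k → mult λ′ (3 ^ k)) j
      ≡⟨ cong₂ _+_ indicator (tailSum-mult ps j) ⟩
    when (3 ^ j ≤? 3 ^ i) 1 + #parts≥3^ j λ′
      ≡⟨ length-filter-∷ (3 ^ j ≤?_) (3 ^ i) λ′ ⟨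
    #parts≥3^ j (3 ^ i ∷ λ′)
      ∎
    where
    open ≡-Reasoning
    indicator : tailSum (suc n) (λ k → when (3 ^ i ≟ 3 ^ k) 1) j ≡ when (3 ^ j ≤? 3 ^ i) 1
    indicator = begin
      tailSum (suc n) (λ k → when (3 ^ i ≟ 3 ^ k) 1) j
        ≡⟨ tailSum-cong (suc n) j (λ k _ → when-⇔ (3 ^ i ≟ 3 ^ k) (i ≟ k) 1 3^-injective (cong (3 ^_))) ⟩
      tailSum (suc n) (λ k → when (i ≟ k) 1) j
        ≡⟨ tailSum-indicator (suc n) j i≤n ⟩
      when (j ≤? i) 1
        ≡⟨ when-⇔ (j ≤? i) (3 ^ j ≤? 3 ^ i) 1 (^-monoʳ-≤ 3) 3^-≤-reflect ⟩
      when (3 ^ j ≤? 3 ^ i) 1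
        ∎

  #parts≥3^-0 : ∀ {λ′} → All (1 ≤_) λ′ → #parts≥3^ 0 λ′ ≡ length λ′
  #parts≥3^-0 all≥1 = cong length (filter-all (1 ≤?_) all≥1)

  #parts≥3^-replicate : ∀ j a → #parts≥3^ j (replicate a (3 ^ j)) ≡ a
  #parts≥3^-replicate j a = trans (cong length (filter-all (3 ^ j ≤?_) (replicate⁺ a ≤-refl))) (length-replicate a)

  #parts≥3^-ones : ∀ j r → 0 < j → #parts≥3^ j (replicate r 1) ≡ 0
  #parts≥3^-ones j r 0<j =
    cong length (filter-none (3 ^ j ≤?_) (replicate⁺ r (<⇒≱ (^-monoʳ-< 3 (s≤s (s≤s z≤n)) 0<j))))

  #parts≥3^-++ : ∀ j xs ys → #parts≥3^ j (xs ++ ys) ≡ #parts≥3^ j xs + #parts≥3^ j ys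
  #parts≥3^-++ j xs ys = trans (cong length (filter-++ (3 ^ j ≤?_) xs ys)) (length-++ (filter (3 ^ j ≤?_) xs))

  weight : ℕ → List (List ℕ) → ℕ
  weight n []        = 0
  weight n (λ′ ∷ L) = 2 ^ (n ∸ length λ′) + weight n L

module TernaryGcd (n : ℕ) where

  open PolynomialRing
  open PolynomialProperties
  open ThreeAdic
  open TailSums
  open CyclotomicFactors
  open TernaryPartitions

  open import Data.Nat using (zero; suc; _+_; _*_; _^_; _∸_; _≤_; _<_; _≤?_; z≤n; s≤s)
  open import Data.Nat.Properties
  open import Data.Nat.DivMod using (_/_; n/1≡n; m*n/n≡m; /-monoˡ-≤; m/n*n≤m)
  open import Data.Integer as ℤ using (+_; 1ℤ)
  import Data.Integer.Properties as ℤ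
  open import Data.List using (List; []; _∷_; _++_; map; replicate; length)
  open import Data.List.Relation.Unary.All as All using (All; []; _∷_)
  open import Data.List.Relation.Unary.All.Properties using (replicate⁺; map⁻)
  open import Data.Product using (_,_; proj₁; proj₂)
  open import Function.Bundles using (Equivalence)
  open import Relation.Binary.PropositionalEquality
  open import Relation.Nullary using (¬_)
  open import Data.Integer.Divisibility.Signed as ℤ using ()

  B : ℕ
  B = suc n

  a : ℕ → ℕ
  a k = (n / 3 ^ k) {{m^n≢0 3 k}}

  hExponent : List ℕ → ℕ → ℕ
  hExponent λ′ k = a k ∸ mult λ′ (3 ^ k)

  g : ℕ → ℕ
  g j = tailSum B a j ∸ a j

  G : Poly
  G = ∏Φ^ B g

  -- The exponent of Φ j in h_{𝒯,λ′} / G.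
  q : List ℕ → ℕ → ℕ
  q λ′ j = a j ∸ #parts≥3^ j λ′

  N : List (List ℕ) → Poly
  N L = sumₚ (map (λ λ′ → ∏Φ^ B (q λ′)) L)

  hFactors≈∏Φ^ : ∀ λ′ K → prodₚ (hFactors n λ′ K) ≈ ∏Φ^ K (tailSum K (hExponent λ′))
  hFactors≈∏Φ^ λ′ zero    = ≈-refl
  hFactors≈∏Φ^ λ′ (suc K) = begin
    onePlusX3k K ^ₚ c K *ₚ prodₚ (hFactors n λ′ K)
      ≈⟨ *ₚ-cong (onePlusX3k^≈∏Φ^ K (c K))
           (≈-trans (hFactors≈∏Φ^ λ′ K) (≈-sym (∏Φ^-suc K _ (tailSum-≥ K c ≤-refl)))) ⟩
    ∏Φ^ (suc K) (λ _ → c K) *ₚ ∏Φ^ (suc K) (tailSum K c)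
      ≈⟨ ∏Φ^-*ₚ (suc K) (λ _ → c K) (tailSum K c) ⟩
    ∏Φ^ (suc K) (λ j → c K + tailSum K c j)
      ≡⟨ ∏Φ^-cong (suc K) (λ j j≤K → cong (_+ tailSum K c j) (sym (when-yes (_ ≤? K) (c K) (≤-pred j≤K)))) ⟩
    ∏Φ^ (suc K) (tailSum (suc K) c)
      ∎
    where
    open ≈-Reasoning
    c : ℕ → ℕ
    c = hExponent λ′

  module _ {λ′} (ternary : IsTernaryPartition n λ′) where

    #parts≤a : ∀ j → #parts≥3^ j λ′ ≤ a j
    #parts≤a j = subst (_≤ a j) (m*n/n≡m (#parts≥3^ j λ′) (3 ^ j) {{m^n≢0 3 j}})
      (/-monoˡ-≤ (3 ^ j) {{m^n≢0 3 j}} (subst (_ ≤_) (proj₂ (proj₂ ternary)) (#parts≥3^-* j λ′)))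

    mult≤a : ∀ k → k < B → mult λ′ (3 ^ k) ≤ a k
    mult≤a k k<B = ≤-trans (≤-tailSum B (λ k → mult λ′ (3 ^ k)) k<B)
      (≤-trans (≤-reflexive (tailSum-mult (parts ternary) k)) (#parts≤a k))

    tailSum-hExponent : ∀ j → tailSum B (hExponent λ′) j ≡ tailSum B a j ∸ #parts≥3^ j λ′
    tailSum-hExponent j = begin
      tailSum B (hExponent λ′) j
        ≡⟨ m+n∸n≡m _ P ⟨
      tailSum B (hExponent λ′) j + P ∸ P
        ≡⟨ cong (λ s → tailSum B (hExponent λ′) j + s ∸ P) (tailSum-mult (parts ternary) j) ⟨
      tailSum B (hExponent λ′) j + tailSum B (λ k → mult λ′ (3 ^ k)) j ∸ P
        ≡⟨ cong (_∸ P) (tailSum-+ B (hExponent λ′) _ j) ⟨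
      tailSum B (λ k → hExponent λ′ k + mult λ′ (3 ^ k)) j ∸ P
        ≡⟨ cong (_∸ P) (tailSum-cong B j (λ k k<B → m∸n+n≡m (mult≤a k k<B))) ⟩
      tailSum B a j ∸ P
        ∎
      where
      open ≡-Reasoning
      P : ℕ
      P = #parts≥3^ j λ′

    g+q≡tailSum : ∀ j → j < B → g j + q λ′ j ≡ tailSum B (hExponent λ′) j
    g+q≡tailSum j j<B = trans (∸-+-∸ (#parts≤a j) (≤-tailSum B a j<B)) (sym (tailSum-hExponent j))

    G*∏q≈hT : G *ₚ ∏Φ^ B (q λ′) ≈ hT n λ′
    G*∏q≈hT = ≈-trans (∏Φ^-*ₚ B g (q λ′)) (≈-trans (≈-reflexive (∏Φ^-cong B g+q≡tailSum)) (≈-sym (hFactors≈∏Φ^ λ′ B)))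

    q-0 : q λ′ 0 ≡ n ∸ length λ′
    q-0 = cong₂ _∸_ (n/1≡n n) (#parts≥3^-0 (pow3-positive (proj₁ (proj₂ ternary))))

  extremal : ℕ → List ℕ
  extremal m = replicate (a m) (3 ^ m) ++ replicate (n ∸ a m * 3 ^ m) 1

  extremal-ternary : ∀ m → IsTernaryPartition n (extremal m)
  extremal-ternary m = ++-ones-ternary n
    (Linked-replicate (a m) (3 ^ m) , replicate⁺ (a m) (m , refl) , sum-replicate (a m) (3 ^ m))
    (m/n*n≤m n (3 ^ m) {{m^n≢0 3 m}})

  q-extremal : ∀ m → q (extremal m) m ≡ 0
  q-extremal m = trans (cong (a m ∸_) #parts≡a) (n∸n≡0 (a m))
    where
    ones : ∀ m → #parts≥3^ m (replicate (n ∸ a m * 3 ^ m) 1) ≡ 0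
    ones zero    = cong (λ r → #parts≥3^ 0 (replicate r 1)) (trans (cong (n ∸_) (trans (*-identityʳ (a 0)) (n/1≡n n))) (n∸n≡0 n))
    ones (suc m) = #parts≥3^-ones (suc m) (n ∸ a (suc m) * 3 ^ suc m) (s≤s z≤n)
    #parts≡a : #parts≥3^ m (extremal m) ≡ a m
    #parts≡a = trans (#parts≥3^-++ m (replicate (a m) (3 ^ m)) _)
      (trans (cong₂ _+_ (#parts≥3^-replicate m (a m)) (ones m)) (+-identityʳ (a m)))

  module _ {L} (ternary : All (IsTernaryPartition n) L) where

    G*N≈∑hT : G *ₚ N L ≈ sumₚ (map (hT n) L)
    G*N≈∑hT = go ternary
      where
      go : ∀ {L} → All (IsTernaryPartition n) L → G *ₚ N L ≈ sumₚ (map (hT n) L)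
      go []                  = *ₚ-zeroʳ G
      go {λ′ ∷ L} (t ∷ ts)  = ≈-trans (*ₚ-distribˡ-+ₚ G (∏Φ^ B (q λ′)) (N L)) (+ₚ-cong (G*∏q≈hT t) (go ts))

    eval-N : eval (N L) 1ℤ ≡ + weight n L
    eval-N = go ternary
      where
      go : ∀ {L} → All (IsTernaryPartition n) L → eval (N L) 1ℤ ≡ + weight n L
      go []                 = refl
      go {λ′ ∷ L} (t ∷ ts) = begin
        eval (∏Φ^ B (q λ′) +ₚ N L) 1ℤ                      ≡⟨ eval-+ₚ (∏Φ^ B (q λ′)) (N L) 1ℤ ⟩
        eval (∏Φ^ B (q λ′)) 1ℤ ℤ.+ eval (N L) 1ℤ           ≡⟨ cong₂ ℤ._+_ (eval-∏Φ^ n (q λ′)) (go ts) ⟩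
        + (2 ^ q λ′ 0) ℤ.+ + weight n L                     ≡⟨ cong (λ e → + (2 ^ e) ℤ.+ + weight n L) (q-0 t) ⟩
        + (2 ^ (n ∸ length λ′)) ℤ.+ + weight n L           ≡⟨ ℤ.pos-+ (2 ^ (n ∸ length λ′)) (weight n L) ⟨
        + (2 ^ (n ∸ length λ′) + weight n L)                ∎
        where open ≡-Reasoning

  isGcd : ∀ {L} → EnumeratesT n L → IsGcdₚ G (map (hT n) L)
  isGcd {L} (_ , ∈L⇔ternary) = LeadPos-∏Φ^ B g , G∣hT ternary , ∣G
    where
    ternary : All (IsTernaryPartition n) L
    ternary = All.tabulate (λ {λ′} → Equivalence.to (∈L⇔ternary λ′))
    G∣hT : ∀ {L} → All (IsTernaryPartition n) L → All (G ∣ₚ_) (map (hT n) L)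
    G∣hT []       = []
    G∣hT {λ′ ∷ _} (t ∷ ts) = (∏Φ^ B (q λ′) , at (G*∏q≈hT t)) ∷ G∣hT ts
    ∣G : ∀ D → All (D ∣ₚ_) (map (hT n) L) → D ∣ₚ G
    ∣G D D∣hT = ∣ₚ-∏Φ^-cancel D G B (λ m → q (extremal m)) 3∤D (s≤s z≤n) (λ m _ → q-extremal m) (λ m _ → D∣G∏q m)
      where
      D∣G∏q : ∀ m → D ∣ₚ G *ₚ ∏Φ^ B (q (extremal m))
      D∣G∏q m = ∣ₚ-respʳ-≈ D _ _ (All.lookup (map⁻ D∣hT) (Equivalence.from (∈L⇔ternary (extremal m)) (extremal-ternary m)))
        (≈-sym (G*∏q≈hT (extremal-ternary m)))
      e : ℕ → ℕ
      e j = g j + q (extremal 0) j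
      3∤D : ¬ 3∣ₚ D
      3∤D = 3∤ₚ-∣ₚ D (∏Φ^ B e) 1ℤ (∣ₚ-respʳ-≈ D _ _ (D∣G∏q 0) (∏Φ^-*ₚ B g (q (extremal 0))))
        (subst (λ z → ¬ (+ 3 ℤ.∣ z)) (sym (eval-∏Φ^ n e)) (3∤2^ (e 0)))

module PartitionEnumeration where

  open TailSums
  open TernaryPartitions

  open import Data.Nat using (ℕ; zero; suc; _+_; _*_; _^_; _∸_; _≤_; _<_; _≥_; _≟_; z≤n; s≤s)
  open import Data.Nat.Properties
  open import Data.Nat.Divisibility using (divides; ∣1⇒≡1)
  open import Function using (id)
  open import Data.Nat.DivMod using (_/_; m/n*n≤m; m*n/n≡m; /-monoˡ-≤)
  open import Data.Nat.ListAction using (sum)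
  open import Data.Nat.ListAction.Properties using (sum-++)
  open import Data.List using (List; []; _∷_; _++_; map; replicate; length; concatMap; downFrom; filter)
  open import Data.List.Properties using (length-++; length-map; length-replicate; map-injective; ++-cancelʳ; filter-++; filter-none; filter-all)
  open import Data.List.Relation.Unary.All as All using (All; []; _∷_)
  open import Data.List.Relation.Unary.All.Properties using (++⁻ˡ; replicate⁺; map⁺; map⁻)
  import Data.List.Relation.Unary.AllPairs as AllPairs
  open import Data.List.Relation.Unary.AllPairs.Properties as AllPairs using ()
  open import Data.List.Relation.Unary.Linked as Linked using (Linked; []; [-]; _∷_)
  open import Data.List.Relation.Unary.Unique.Propositional using (Unique)
  import Data.List.Relation.Unary.Unique.Propositional.Properties as Unique
  open import Data.List.Relation.Binary.Disjoint.Propositional using (Disjoint)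
  open import Data.List.Membership.Propositional using (_∈_; find; lose)
  open import Data.List.Membership.Propositional.Properties
    using (∈-map⁺; ∈-map⁻; ∈-concatMap⁺; ∈-concatMap⁻; ∈-downFrom⁺; ∈-downFrom⁻)
  open import Data.List.Relation.Unary.Any using (here)
  open import Data.Product using (∃; ∃₂; _×_; _,_)
  open import Data.Empty using (⊥-elim)
  open import Function.Bundles using (mk⇔)
  open import Relation.Binary.PropositionalEquality
  open import Data.Nat.Tactic.RingSolver using (solve-∀)

  embed : ℕ → ℕ → List ℕ → List ℕ
  embed n m μ = map (3 *_) μ ++ replicate (n ∸ 3 * m) 1

  -- partitions f n lists the ternary partitions of n whose parts are at most 3 ^ f.
  partitions : ℕ → ℕ → List (List ℕ)
  partitions zero    n = replicate n 1 ∷ []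
  partitions (suc f) n = concatMap (λ m → map (embed n m) (partitions f m)) (downFrom (suc (n / 3)))

  sum-3* : ∀ xs → sumℕ (map (3 *_) xs) ≡ 3 * sumℕ xs
  sum-3* []       = refl
  sum-3* (x ∷ xs) = trans (cong (3 * x +_) (sum-3* xs)) (sym (*-distribˡ-+ 3 x (sumℕ xs)))

  3*-ternary : ∀ {m μ} → IsTernaryPartition m μ → IsTernaryPartition (3 * m) (map (3 *_) μ)
  3*-ternary {m} {μ} (linked , pow3 , sum≡m) =
    linked-3* linked , pow3-3* pow3 , trans (sum-3* μ) (cong (3 *_) sum≡m)
    where
    linked-3* : ∀ {xs} → Linked _≥_ xs → Linked _≥_ (map (3 *_) xs)
    linked-3* []          = []
    linked-3* [-]         = [-]
    linked-3* (x≥y ∷ l)  = *-monoʳ-≤ 3 x≥y ∷ linked-3* l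
    pow3-3* : ∀ {xs} → All IsPow3 xs → All IsPow3 (map (3 *_) xs)
    pow3-3* []                 = []
    pow3-3* ((i , refl) ∷ ps) = (suc i , refl) ∷ pow3-3* ps

  3m≤n : ∀ {m n} → m < suc (n / 3) → 3 * m ≤ n
  3m≤n {m} {n} m<1+n/3 = ≤-trans (*-monoʳ-≤ 3 (≤-pred m<1+n/3)) (subst (_≤ n) (*-comm (n / 3) 3) (m/n*n≤m n 3))

  partitions-sound : ∀ f n {λ′} → λ′ ∈ partitions f n → IsTernaryPartition n λ′
  partitions-sound zero    n (here refl) = ++-ones-ternary n ([] , [] , refl) z≤n
  partitions-sound (suc f) n λ′∈ with find (∈-concatMap⁻ _ {xs = downFrom (suc (n / 3))} λ′∈)
  ... | m , m∈ , λ′∈block with ∈-map⁻ (embed n m) λ′∈block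
  ...   | μ , μ∈ , refl = ++-ones-ternary n (3*-ternary (partitions-sound f m μ∈)) (3m≤n (∈-downFrom⁻ m∈))

  ones-after-1 : ∀ {xs} → Linked _≥_ (1 ∷ xs) → All IsPow3 xs → xs ≡ replicate (length xs) 1
  ones-after-1 {[]}     _           _                  = refl
  ones-after-1 {x ∷ xs} (1≥x ∷ l) ((i , refl) ∷ ps) with ≤-antisym 1≥x (m^n>0 3 i)
  ... | 3^i≡1 = cong₂ _∷_ 3^i≡1 (ones-after-1 (subst (λ y → Linked _≥_ (y ∷ xs)) 3^i≡1 l) ps)

  decompose : ∀ {λ′} → Linked _≥_ λ′ → All IsPow3 λ′ →
              ∃₂ λ μ r → λ′ ≡ map (3 *_) μ ++ replicate r 1 × Linked _≥_ μ × All IsPow3 μ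
  decompose {[]}     _ _ = [] , 0 , refl , [] , []
  decompose {_ ∷ xs} l ((zero , refl) ∷ ps) = [] , suc (length xs) , cong (1 ∷_) (ones-after-1 l ps) , [] , []
  decompose {_ ∷ xs} l ((suc i , refl) ∷ ps) with decompose (Linked.tail l) ps
  ... | μ , r , refl , lμ , pμ = 3 ^ i ∷ μ , r , refl , linked μ l lμ , (i , refl) ∷ pμ
    where
    linked : ∀ μ → Linked _≥_ (3 ^ suc i ∷ map (3 *_) μ ++ replicate r 1) → Linked _≥_ μ → Linked _≥_ (3 ^ i ∷ μ)
    linked []      _            _  = [-]
    linked (y ∷ μ) (3^1+i≥3y ∷ _) lμ = *-cancelˡ-≤ 3 3^1+i≥3y ∷ lμ

  embed-surjective : ∀ {n λ′} → IsTernaryPartition n λ′ →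
                     ∃ λ μ → IsTernaryPartition (sumℕ μ) μ × 3 * sumℕ μ ≤ n × λ′ ≡ embed n (sumℕ μ) μ
  embed-surjective {n} (linked , pow3 , sum≡n) with decompose linked pow3
  ... | μ , r , refl , lμ , pμ =
    μ , (lμ , pμ , refl) , subst (3 * sumℕ μ ≤_) 3m+r≡n (m≤m+n _ r) , cong (λ r → map (3 *_) μ ++ replicate r 1) r≡
    where
    3m+r≡n : 3 * sumℕ μ + r ≡ n
    3m+r≡n = trans (sym (trans (sum-++ (map (3 *_) μ) _) (cong₂ _+_ (sum-3* μ) (trans (sum-replicate r 1) (*-identityʳ r))))) sum≡n
    r≡ : r ≡ n ∸ 3 * sumℕ μ
    r≡ = trans (sym (m+n∸m≡n (3 * sumℕ μ) r)) (cong (_∸ 3 * sumℕ μ) 3m+r≡n)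

  partitions-complete : ∀ f {n λ′} → IsTernaryPartition n λ′ → All (_≤ 3 ^ f) λ′ → λ′ ∈ partitions f n
  partitions-complete zero {n} ternary ≤1 with embed-surjective ternary
  ... | []    , _ , _ , refl = here refl
  ... | y ∷ μ , (_ , (i , refl) ∷ _ , _) , _ , refl =
    ⊥-elim (<⇒≱ (s≤s (s≤s z≤n)) (≤-trans (*-monoʳ-≤ 3 (m^n>0 3 i)) (All.head ≤1)))
  partitions-complete (suc f) {n} ternary ≤3^[1+f] with embed-surjective ternary
  ... | μ , μ-ternary , 3m≤n , refl =
    ∈-concatMap⁺ _ (lose (∈-downFrom⁺ (s≤s m≤n/3)) (∈-map⁺ (embed n (sumℕ μ)) (partitions-complete f μ-ternary μ≤3^f)))
    where
    m≤n/3 : sumℕ μ ≤ n / 3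
    m≤n/3 = subst (_≤ n / 3) (m*n/n≡m (sumℕ μ) 3) (/-monoˡ-≤ 3 (subst (_≤ n) (*-comm 3 (sumℕ μ)) 3m≤n))
    μ≤3^f : All (_≤ 3 ^ f) μ
    μ≤3^f = All.map (*-cancelˡ-≤ 3) (map⁻ (++⁻ˡ (map (3 *_) μ) ≤3^[1+f]))

  embed-injective : ∀ n m {μ μ′} → embed n m μ ≡ embed n m μ′ → μ ≡ μ′
  embed-injective n m e = map-injective (*-cancelˡ-≡ _ _ 3) (++-cancelʳ (replicate (n ∸ 3 * m) 1) _ _ e)

  mult-embed-1 : ∀ n m μ → mult (embed n m μ) 1 ≡ n ∸ 3 * m
  mult-embed-1 n m μ = begin
    length (filter (_≟ 1) (map (3 *_) μ ++ replicate (n ∸ 3 * m) 1))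
      ≡⟨ cong length (filter-++ (_≟ 1) (map (3 *_) μ) _) ⟩
    length (filter (_≟ 1) (map (3 *_) μ) ++ filter (_≟ 1) (replicate (n ∸ 3 * m) 1))
      ≡⟨ cong₂ (λ xs ys → length (xs ++ ys))
           (filter-none (_≟ 1) (map⁺ {xs = μ} (All.tabulate λ {x} _ → 3x≢1 x)))
           (filter-all (_≟ 1) (replicate⁺ (n ∸ 3 * m) refl)) ⟩
    length (replicate (n ∸ 3 * m) 1)
      ≡⟨ length-replicate (n ∸ 3 * m) ⟩
    n ∸ 3 * m
      ∎
    where
    open ≡-Reasoning
    3x≢1 : ∀ x → 3 * x ≢ 1
    3x≢1 x 3x≡1 with () ← ∣1⇒≡1 (divides x (trans (sym 3x≡1) (*-comm 3 x)))

  embed-≡⇒≡ : ∀ {n m m′ μ μ′} → 3 * m ≤ n → 3 * m′ ≤ n → embed n m μ ≡ embed n m′ μ′ → m ≡ m′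
  embed-≡⇒≡ {n} {m} {m′} {μ} {μ′} 3m≤n 3m′≤n e = *-cancelˡ-≡ m m′ 3 (begin
    3 * m                       ≡⟨ m∸[m∸n]≡n 3m≤n ⟨
    n ∸ (n ∸ 3 * m)             ≡⟨ cong (n ∸_) (mult-embed-1 n m μ) ⟨
    n ∸ mult (embed n m μ) 1    ≡⟨ cong (λ λ′ → n ∸ mult λ′ 1) e ⟩
    n ∸ mult (embed n m′ μ′) 1  ≡⟨ cong (n ∸_) (mult-embed-1 n m′ μ′) ⟩
    n ∸ (n ∸ 3 * m′)            ≡⟨ m∸[m∸n]≡n 3m′≤n ⟩
    3 * m′                      ∎)
    where open ≡-Reasoning

  partitions-unique : ∀ f n → Unique (partitions f n)
  partitions-unique zero    n = [] AllPairs.∷ AllPairs.[]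
  partitions-unique (suc f) n = Unique.concat⁺
    (map⁺ (All.tabulate λ {m} _ → Unique.map⁺ (embed-injective n m) (partitions-unique f m)))
    (AllPairs.map⁺ (AllPairs.applyDownFrom⁺₁ id (suc (n / 3)) disjoint))
    where
    disjoint : ∀ {i j} → j < i → i < suc (n / 3) →
               Disjoint (map (embed n i) (partitions f i)) (map (embed n j) (partitions f j))
    disjoint {i} {j} j<i i<K (v∈i , v∈j) with ∈-map⁻ (embed n i) v∈i | ∈-map⁻ (embed n j) v∈j
    ... | μ , _ , refl | μ′ , _ , e = <⇒≢ j<i (sym (embed-≡⇒≡ (3m≤n i<K) (3m≤n (<-trans j<i i<K)) e))

  partitions-enumerate : ∀ f n → n ≤ 3 ^ f → EnumeratesT n (partitions f n)
  partitions-enumerate f n n≤3^f = partitions-unique f n , λ λ′ → mk⇔ (partitions-sound f n)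
    (λ ternary → partitions-complete f ternary (All.map (λ p≤n → ≤-trans p≤n n≤3^f) (parts≤n ternary)))

  weight-++ : ∀ n xs ys → weight n (xs ++ ys) ≡ weight n xs + weight n ys
  weight-++ n []       ys = refl
  weight-++ n (x ∷ xs) ys = trans (cong (2 ^ (n ∸ length x) +_) (weight-++ n xs ys))
    (sym (+-assoc (2 ^ (n ∸ length x)) (weight n xs) (weight n ys)))

  2^-embed : ∀ {n m} μ → 3 * m ≤ n → length μ ≤ m → 2 ^ (n ∸ length (embed n m μ)) ≡ 4 ^ m * 2 ^ (m ∸ length μ)
  2^-embed {n} {m} μ 3m≤n len≤m = begin
    2 ^ (n ∸ length (embed n m μ))          ≡⟨ cong (λ l → 2 ^ (n ∸ l)) length-embed ⟩
    2 ^ (n ∸ ((n ∸ 3 * m) + length μ))      ≡⟨ cong (2 ^_) (∸-+-assoc n (n ∸ 3 * m) (length μ)) ⟨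
    2 ^ (n ∸ (n ∸ 3 * m) ∸ length μ)        ≡⟨ cong (λ k → 2 ^ (k ∸ length μ)) (trans (m∸[m∸n]≡n 3m≤n) (3m≡2m+m m)) ⟩
    2 ^ (2 * m + m ∸ length μ)              ≡⟨ cong (2 ^_) (+-∸-assoc (2 * m) len≤m) ⟩
    2 ^ (2 * m + (m ∸ length μ))            ≡⟨ ^-distribˡ-+-* 2 (2 * m) (m ∸ length μ) ⟩
    2 ^ (2 * m) * 2 ^ (m ∸ length μ)        ≡⟨ cong (_* 2 ^ (m ∸ length μ)) (^-*-assoc 2 2 m) ⟨
    4 ^ m * 2 ^ (m ∸ length μ)              ∎
    where
    open ≡-Reasoning
    3m≡2m+m : ∀ m → 3 * m ≡ 2 * m + m
    3m≡2m+m = solve-∀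
    length-embed : length (embed n m μ) ≡ (n ∸ 3 * m) + length μ
    length-embed = trans (length-++ (map (3 *_) μ))
      (trans (cong₂ _+_ (length-map (3 *_) μ) (length-replicate (n ∸ 3 * m))) (+-comm (length μ) _))

  weight-embed : ∀ {n m} X → 3 * m ≤ n → All (λ μ → length μ ≤ m) X → weight n (map (embed n m) X) ≡ 4 ^ m * weight m X
  weight-embed {m = m} []      3m≤n []             = sym (*-zeroʳ (4 ^ m))
  weight-embed {m = m} (μ ∷ X) 3m≤n (len≤m ∷ lens) =
    trans (cong₂ _+_ (2^-embed μ 3m≤n len≤m) (weight-embed X 3m≤n lens)) (sym (*-distribˡ-+ (4 ^ m) _ (weight m X)))

  length≤sum : ∀ {xs} → All (1 ≤_) xs → length xs ≤ sumℕ xs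
  length≤sum []           = z≤n
  length≤sum (1≤x ∷ 1≤xs) = +-mono-≤ 1≤x (length≤sum 1≤xs)

  weight-partitions : ∀ f n → weight n (partitions (suc f) n) ≡
                      sum (map (λ m → 4 ^ m * weight m (partitions f m)) (downFrom (suc (n / 3))))
  weight-partitions f n = go (downFrom (suc (n / 3))) (All.tabulate (λ m∈ → 3m≤n (∈-downFrom⁻ m∈)))
    where
    lengths : ∀ m → All (λ μ → length μ ≤ m) (partitions f m)
    lengths m = All.tabulate λ {μ} μ∈ → let (_ , pow3 , sum≡m) = partitions-sound f m μ∈ in
      subst (length μ ≤_) sum≡m (length≤sum (pow3-positive pow3))
    go : ∀ ms → All (λ m → 3 * m ≤ n) ms →
         weight n (concatMap (λ m → map (embed n m) (partitions f m)) ms) ≡ sum (map (λ m → 4 ^ m * weight m (partitions f m)) ms)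
    go []       []              = refl
    go (m ∷ ms) (3m≤n ∷ bounds) = trans (weight-++ n (map (embed n m) (partitions f m)) _)
      (cong₂ _+_ (weight-embed (partitions f m) 3m≤n (lengths m)) (go ms bounds))

  weight-partitions-0 : ∀ f → weight 0 (partitions f 0) ≡ 1
  weight-partitions-0 zero    = refl
  weight-partitions-0 (suc f) = trans (weight-partitions f 0)
    (trans (+-identityʳ _) (trans (+-identityʳ _) (weight-partitions-0 f)))

open import Data.Nat using (ℕ; _≤_; _^_)
open import Data.Integer using (ℤ; +_; _-_; _*_; 1ℤ)
open import Data.List using (List; map)
open import Data.Product using (_×_)
open import Relation.Binary.PropositionalEquality using (_≡_)

open import Data.Nat as ℕ using (zero; suc)
import Data.Nat.Properties as ℕ
open import Data.Nat.DivMod using (_/_; m*n/n≡m; m/n≤m; m<n⇒m/n≡0; +-distrib-/-∣ˡ)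
open import Data.Nat.Divisibility using (divides)
open import Data.Nat.ListAction using (sum)
import Data.Integer as ℤ
import Data.Integer.Properties as ℤ
open import Data.Integer.Tactic.RingSolver using (solve-∀)
open import Data.List using (downFrom)
open import Data.List.Properties using (map-cong-local)
open import Data.List.Relation.Unary.All as All using (All)
open import Data.List.Membership.Propositional using (_∈_)
open import Data.List.Membership.Propositional.Properties using (∈-downFrom⁻)
open import Data.Product using (_,_)
open import Relation.Binary.PropositionalEquality using (sym; trans; cong; cong₂; module ≡-Reasoning)

open PolynomialRing using (at)
open TernaryPartitions using (weight; n<3^n)
open PartitionEnumeration

NumAtOne : (ℕ → ℤ) → Set
NumAtOne t = ∀ n → 1 ≤ n → (L : List (List ℕ)) → EnumeratesT n L →
             (G N : Poly) → IsGcdₚ G (map (hT n) L) →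
             G *ₚ N ≈ₚ sumₚ (map (hT n) L) → t n ≡ eval N 1ℤ

[3n+r]/3≡n : ∀ n r → r ℕ.< 3 → (3 ℕ.* n ℕ.+ r) / 3 ≡ n
[3n+r]/3≡n n r r<3 = begin
  (3 ℕ.* n ℕ.+ r) / 3      ≡⟨ +-distrib-/-∣ˡ r (divides n (ℕ.*-comm 3 n)) ⟩
  3 ℕ.* n / 3 ℕ.+ r / 3    ≡⟨ cong₂ ℕ._+_ (trans (cong (_/ 3) (ℕ.*-comm 3 n)) (m*n/n≡m n 3)) (m<n⇒m/n≡0 r<3) ⟩
  n ℕ.+ 0                  ≡⟨ ℕ.+-identityʳ n ⟩
  n                        ∎
  where open ≡-Reasoning

module _ {t : ℕ → ℤ} (t0 : t 0 ≡ 1ℤ) (t-num : NumAtOne t) where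

  t≡weight : ∀ f n → n ≤ 3 ^ f → t n ≡ + weight n (partitions f n)
  t≡weight f zero    _       = trans t0 (cong +_ (sym (weight-partitions-0 f)))
  t≡weight f (suc n) n≤3^f = trans
    (t-num (suc n) (ℕ.s≤s ℕ.z≤n) L enum G (N L) (isGcd enum) (at (G*N≈∑hT ternary)))
    (eval-N ternary)
    where
    open TernaryGcd (suc n)
    L : List (List ℕ)
    L = partitions f (suc n)
    enum : EnumeratesT (suc n) L
    enum = partitions-enumerate f (suc n) n≤3^f
    ternary : All (IsTernaryPartition (suc n)) L
    ternary = All.tabulate (partitions-sound f (suc n))

  w : ℕ → ℕ
  w n = weight n (partitions n n)

  t≡w : ∀ n → t n ≡ + w n
  t≡w n = t≡weight n n (ℕ.<⇒≤ (n<3^n n))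

  -- Independence of the fuel f, obtained from t rather than proved combinatorially.
  weight-partitions≡w : ∀ f n → n ≤ 3 ^ f → weight n (partitions f n) ≡ w n
  weight-partitions≡w f n n≤3^f = ℤ.+-injective (trans (sym (t≡weight f n n≤3^f)) (t≡w n))

  S : ℕ → ℕ
  S k = sum (map (λ m → 4 ^ m ℕ.* w m) (downFrom (suc k)))

  w≡S : ∀ n → w n ≡ S (n / 3)
  w≡S n = begin
    w n
      ≡⟨ weight-partitions≡w (suc n) n (ℕ.≤-trans (ℕ.<⇒≤ (n<3^n n)) (ℕ.^-monoʳ-≤ 3 (ℕ.n≤1+n n))) ⟨
    weight n (partitions (suc n) n)
      ≡⟨ weight-partitions n n ⟩
    sum (map (λ m → 4 ^ m ℕ.* weight m (partitions n m)) ms)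
      ≡⟨ cong sum (map-cong-local (All.tabulate λ {m} m∈ →
           cong (4 ^ m ℕ.*_) (weight-partitions≡w n m (m≤3^n m∈)))) ⟩
    S (n / 3)
      ∎
    where
    open ≡-Reasoning
    ms : List ℕ
    ms = downFrom (suc (n / 3))
    m≤3^n : ∀ {m} → m ∈ ms → m ≤ 3 ^ n
    m≤3^n m∈ = ℕ.≤-trans (ℕ.≤-pred (∈-downFrom⁻ m∈)) (ℕ.≤-trans (m/n≤m n 3) (ℕ.<⇒≤ (n<3^n n)))

  t-3n+r : ∀ n r → r ℕ.< 3 → t (3 ℕ.* n ℕ.+ r) ≡ + S n
  t-3n+r n r r<3 = trans (t≡w (3 ℕ.* n ℕ.+ r)) (cong +_ (trans (w≡S (3 ℕ.* n ℕ.+ r)) (cong S ([3n+r]/3≡n n r r<3))))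

  t-3n : ∀ n → t (3 ℕ.* n) ≡ + S n
  t-3n n = trans (cong t (sym (ℕ.+-identityʳ (3 ℕ.* n)))) (t-3n+r n 0 (ℕ.s≤s ℕ.z≤n))

  t-difference : ∀ k → t (3 ℕ.* suc k) - t (3 ℕ.* suc k ℕ.∸ 2) ≡ + (2 ^ (2 ℕ.* suc k)) * t (suc k)
  t-difference k = begin
    t (3 ℕ.* suc k) - t (3 ℕ.* suc k ℕ.∸ 2)
      ≡⟨ cong₂ _-_ (t-3n (suc k)) (trans (cong t 3[1+k]∸2≡3k+1) (t-3n+r k 1 (ℕ.s≤s (ℕ.s≤s ℕ.z≤n)))) ⟩
    + S (suc k) - + S k                              ≡⟨ cong (_- + S k) (ℤ.pos-+ (4 ^ suc k ℕ.* w (suc k)) (S k)) ⟩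
    (+ (4 ^ suc k ℕ.* w (suc k)) ℤ.+ + S k) - + S k  ≡⟨ cancel (+ (4 ^ suc k ℕ.* w (suc k))) (+ S k) ⟩
    + (4 ^ suc k ℕ.* w (suc k))                      ≡⟨ ℤ.pos-* (4 ^ suc k) (w (suc k)) ⟩
    + (4 ^ suc k) * + w (suc k)                      ≡⟨ cong₂ _*_ (cong +_ (ℕ.^-*-assoc 2 2 (suc k))) (sym (t≡w (suc k))) ⟩
    + (2 ^ (2 ℕ.* suc k)) * t (suc k)                ∎
    where
    open ≡-Reasoning
    3[1+k]∸2≡3k+1 : 3 ℕ.* suc k ℕ.∸ 2 ≡ 3 ℕ.* k ℕ.+ 1
    3[1+k]∸2≡3k+1 = trans (cong (ℕ._∸ 2) (ℕ.*-suc 3 k)) (ℕ.+-comm 1 (3 ℕ.* k))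
    cancel : ∀ a b → (a ℤ.+ b) - b ≡ a
    cancel = solve-∀

theorem5 : (t : ℕ → ℤ) → t 0 ≡ 1ℤ →
           (∀ n → 1 ≤ n → (L : List (List ℕ)) → EnumeratesT n L →
             (G N : Poly) → IsGcdₚ G (map (hT n) L) →
             G *ₚ N ≈ₚ sumₚ (map (hT n) L) → t n ≡ eval N 1ℤ) →
           (∀ n → (t (3 Data.Nat.* n) ≡ t (3 Data.Nat.* n Data.Nat.+ 1))
                  × (t (3 Data.Nat.* n) ≡ t (3 Data.Nat.* n Data.Nat.+ 2)))
           × (∀ n → 1 ≤ n →
                t (3 Data.Nat.* n) - t (3 Data.Nat.* n Data.Nat.∸ 2)
                  ≡ (+ (2 ^ (2 Data.Nat.* n))) * t n)
theorem5 t t0 t-num =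
  (λ n → trans (t-3n t0 t-num n) (sym (t-3n+r t0 t-num n 1 (ℕ.s≤s (ℕ.s≤s ℕ.z≤n)))) ,
         trans (t-3n t0 t-num n) (sym (t-3n+r t0 t-num n 2 ℕ.≤-refl))) ,
  λ { (suc k) _ → t-difference t0 t-num k }
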